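{- Let $M$ be a list of integers (all entries at least $2$) and let $\lambda$, $n$ and $m\geq 3$ be positive integers. If there is an $(M,m,2)$-decomposition of $\lambda K_n$ in which an $m$-cycle and a $2$-cycle share at least one vertex, then there is an $(M,m-1,3)$-decomposition of $\lambda K_n$.
   Context: Graphs may have multiple edges; $\lambda K_n$ is the complete multigraph on $n$ vertices with each pair of distinct vertices joined by $\lambda$ edges. For $m\geq 2$ an $m$-cycle has $m$ distinct vertices $v_1,\dots,v_m$ and edges $v_1v_2,\dots,v_mv_1$ (a $2$-cycle is two parallel edges). $(M,a,b)$ is the list $M$ with entries $a,b$ appended. For a list $L=(m_1,\ldots,m_t)$, an $(L)$-decomposition of $\lambda K_n$ is, when $\lambda(n-1)$ is even, a partition of its edge set into cycles $G_1,\dots,G_t$ with $G_i$ an $m_i$-cycle, and, when $\lambda(n-1)$ is odd, a partition of its edge set into such cycles together with a perfect matching. -}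

module Defs where

open import Data.Nat using (ℕ; zero; suc; _+_; _*_; _∸_; _≤_; _%_)
open import Data.Fin using (Fin)
open import Data.Fin.Properties using (_≟_)
open import Data.List using (List; []; _∷_; _++_; length; filter; map; concatMap)
open import Data.List.Relation.Unary.All using (All)
open import Data.List.Relation.Unary.Unique.Propositional using (Unique)
open import Data.List.Membership.Propositional using (_∈_)
open import Data.Product using (_×_; _,_; proj₁; proj₂; Σ; ∃-syntax)
open import Data.Sum using (_⊎_)
open import Relation.Nullary using (¬_)
open import Relation.Nullary.Decidable using (_×-dec_; _⊎-dec_)
open import Relation.Binary.PropositionalEquality using (_≡_; _≢_)

-- An (oriented) edge is an ordered pair of vertices; edges are compared as
-- unordered pairs.
Edge : ℕ → Set
Edge n = Fin n × Fin n

SameEdge : ∀ {n} → Fin n → Fin n → Edge n → Set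
SameEdge u v (a , b) = (a ≡ u × b ≡ v) ⊎ (a ≡ v × b ≡ u)

sameEdge? : ∀ {n} (u v : Fin n) (e : Edge n) → Relation.Nullary.Dec (SameEdge u v e)
sameEdge? u v (a , b) = ((a ≟ u) ×-dec (b ≟ v)) ⊎-dec ((a ≟ v) ×-dec (b ≟ u))

mult : ∀ {n} → Fin n → Fin n → List (Edge n) → ℕ
mult u v es = length (filter (sameEdge? u v) es)

-- edges v1v2, v2v3, ..., v_{k-1}v_k, v_k v1 of the closed walk through the
-- vertex sequence (v1,...,vk); for a 2-cycle (v1,v2) these are two parallel
-- copies of v1v2.
closeEdges : ∀ {n} → Fin n → List (Fin n) → List (Edge n)
closeEdges f [] = []
closeEdges f (x ∷ []) = (x , f) ∷ []
closeEdges f (x ∷ y ∷ r) = (x , y) ∷ closeEdges f (y ∷ r)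

cycleEdges : ∀ {n} → List (Fin n) → List (Edge n)
cycleEdges [] = []
cycleEdges (x ∷ xs) = closeEdges x (x ∷ xs)

IsCycle : ∀ {n} → ℕ → List (Fin n) → Set
IsCycle k vs = length vs ≡ k × 2 ≤ k × Unique vs

Incident : ∀ {n} → Fin n → Edge n → Set
Incident v (a , b) = (a ≡ v) ⊎ (b ≡ v)

incident? : ∀ {n} (v : Fin n) (e : Edge n) → Relation.Nullary.Dec (Incident v e)
incident? v (a , b) = (a ≟ v) ⊎-dec (b ≟ v)

IsPerfectMatching : (n : ℕ) → List (Edge n) → Set
IsPerfectMatching n es =
  All (λ e → proj₁ e ≢ proj₂ e) es ×
  (∀ (v : Fin n) → length (filter (incident? v) es) ≡ 1)

record Decomposition (L : List ℕ) (l n : ℕ) : Set where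
  field
    cycles   : List (List (Fin n))
    matching : List (Edge n)
    lengths  : map length cycles ≡ L
    areCycles : All (λ c → IsCycle (length c) c) cycles
    evenCase : (l * (n ∸ 1)) % 2 ≡ 0 → matching ≡ []
    oddCase  : (l * (n ∸ 1)) % 2 ≡ 1 → IsPerfectMatching n matching
    covers   : ∀ (u v : Fin n) → u ≢ v →
               mult u v (concatMap cycleEdges cycles ++ matching) ≡ l

LastTwoShareVertex : ∀ {L l n} → Decomposition L l n → Set
LastTwoShareVertex {n = n} D =
  ∃[ Gs ] ∃[ C ] ∃[ E ]
    (Decomposition.cycles D ≡ Gs ++ C ∷ E ∷ []) × (∃[ v ] (v ∈ C × v ∈ E))

module Submission where

-- Write the 2-cycle as the double edge vw.  All other cycles and the
-- matching form a packing K, and only its "leave" L = C ∪ {vw, vw} has to be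
-- redecomposed, which is done with (α,β)-switches: every vertex x ∉ {α,β}
-- is joined to α and to β equally often in λK_n, so exchanging α and β on a
-- suitable chain of edges of K yields a packing K' with the same cycle
-- lengths that covers the leave obtained from L by exchanging the poles of
-- one edge at the origin x and of one edge at a terminus y (switchLeave).
-- Counting edges of L at the poles restricts y to a few vertices, and each
-- of them produces the required (m-1)-cycle and 3-cycle.

open import Defs
open import Data.Nat hiding (_≟_)
import Data.Nat as ℕ
open import Data.Nat.Properties hiding (_≟_)
open import Data.Nat.DivMod using (m%n<n)
open import Data.Nat.Tactic.RingSolver using (solve-∀)
open import Data.Fin using (Fin)
open import Data.Fin.Properties using (_≟_)
open import Data.Bool using (Bool; true; false; not)
import Data.Bool.Properties as BP
open import Data.List
open import Data.List.Properties
open import Data.List.Membership.Propositional using (_∈_; _∉_)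
open import Data.List.Membership.Propositional.Properties using (∈-++⁺ˡ; ∈-++⁺ʳ; ∈-++⁻; ∈-∃++; ∈-filter⁻)
open import Data.List.Relation.Unary.Any using (here; there; any?)
open import Data.List.Relation.Unary.All as All using (All; []; _∷_) renaming (lookup to All-lookup)
import Data.List.Relation.Unary.All.Properties as AllP
open import Data.List.Relation.Unary.All.Properties using (¬Any⇒All¬; All¬⇒¬Any)
open import Data.List.Relation.Unary.AllPairs as AllPairs using ([]; _∷_)
open import Data.List.Relation.Unary.Unique.Propositional using (Unique)
open import Data.List.Relation.Unary.Unique.Propositional.Properties using (Unique[x∷xs]⇒x∉xs)
open import Data.List.Relation.Binary.Permutation.Propositional using (_↭_; prep; swap; ↭-sym; ↭-trans; ↭-refl; ↭⇒↭ₛ)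
open import Data.List.Relation.Binary.Permutation.Propositional.Properties using (∈-resp-↭; ↭-length; ++⁺ˡ; ++⁺ʳ; ↭-reverse; shift; ++-comm; All-resp-↭; map⁺; filter-↭)
import Data.List.Relation.Binary.Permutation.Setoid.Properties as SP
import Data.Product.Properties as PP
open import Data.Product using (Σ; _×_; _,_; proj₁; proj₂; Σ-syntax)
open import Data.Sum using (_⊎_; inj₁; inj₂)
open import Data.Empty
open import Relation.Nullary
open import Level using (0ℓ)
open import Relation.Unary using (Pred; Decidable)
open import Relation.Binary.PropositionalEquality

module _ {X : Set} where
  uniq-↭ : ∀ {xs ys : List X} → xs ↭ ys → Unique xs → Unique ys
  uniq-↭ p u = SP.Unique-resp-↭ (setoid X) (↭⇒↭ₛ p) u

  uniq-cons : ∀ {x : X} {xs} → x ∉ xs → Unique xs → Unique (x ∷ xs)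
  uniq-cons {xs = xs} p u = ¬Any⇒All¬ xs p ∷ u

  uniq-mid : ∀ {x : X} ys zs → Unique (ys ++ x ∷ zs) → x ∉ ys ++ zs
  uniq-mid {x} ys zs u = Unique[x∷xs]⇒x∉xs (uniq-↭ (shift x ys zs) u)

  uniq-drop : ∀ (ys : List X) y zs → Unique (ys ++ y ∷ zs) → Unique (ys ++ zs)
  uniq-drop ys y zs u = AllPairs.tail (uniq-↭ (shift y ys zs) u)

  ∉∷ : ∀ {x y : X} {xs} → x ≢ y → x ∉ xs → x ∉ y ∷ xs
  ∉∷ xy nx (here q) = xy q
  ∉∷ xy nx (there m) = nx m

  ∉++ : ∀ {x : X} xs {ys} → x ∉ xs → x ∉ ys → x ∉ xs ++ ys
  ∉++ xs nx ny m with ∈-++⁻ xs m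
  ... | inj₁ q = nx q
  ... | inj₂ q = ny q

  ∉-++ˡ : ∀ {x : X} xs {ys} → x ∉ xs ++ ys → x ∉ xs
  ∉-++ˡ xs p q = p (∈-++⁺ˡ q)

  ∉-++ʳ : ∀ {x : X} xs {ys} → x ∉ xs ++ ys → x ∉ ys
  ∉-++ʳ xs p q = p (∈-++⁺ʳ xs q)

  ∈-∉⇒≢ : ∀ {x y : X} {xs} → x ∉ xs → y ∈ xs → y ≢ x
  ∈-∉⇒≢ nx m refl = nx m

  lastOf : X → List X → X
  lastOf r [] = r
  lastOf r (x ∷ xs) = lastOf x xs

  lastOf∈ : ∀ r R → lastOf r R ∈ r ∷ R
  lastOf∈ r [] = here refl
  lastOf∈ r (x ∷ xs) = there (lastOf∈ x xs)

  lastOf-snoc : ∀ (r : X) R x → lastOf r (R ++ x ∷ []) ≡ x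
  lastOf-snoc r [] x = refl
  lastOf-snoc r (y ∷ R) x = lastOf-snoc y R x

  length-++-∷ : ∀ (ys : List X) x zs → 1 ≤ length (ys ++ x ∷ zs)
  length-++-∷ [] x zs = s≤s z≤n
  length-++-∷ (_ ∷ ys) x zs = s≤s z≤n

  length-remove : ∀ (ys : List X) zs {x k} → length (ys ++ x ∷ zs) ≤ suc k → length (ys ++ zs) ≤ k
  length-remove ys zs {x} len = ≤-pred (subst (_≤ _) (length-++-sucʳ ys x zs) len)

  reverse-ends : ∀ (x : X) A z → reverse (x ∷ A ++ z ∷ []) ≡ z ∷ reverse A ++ x ∷ []
  reverse-ends x A z = trans (unfold-reverse x (A ++ z ∷ [])) (cong (_++ x ∷ []) (reverse-++ A (z ∷ [])))

  ++-snoc₂-injective : ∀ (xs ys : List X) a b c d → xs ++ a ∷ b ∷ [] ≡ ys ++ c ∷ d ∷ [] → xs ≡ ys × a ≡ c × b ≡ d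
  ++-snoc₂-injective xs ys a b c d eq with ∷ʳ-injective (xs ++ a ∷ []) (ys ++ c ∷ []) (trans (++-assoc xs (a ∷ []) (b ∷ [])) (trans eq (sym (++-assoc ys (c ∷ []) (d ∷ [])))))
  ... | e1 , e2 with ∷ʳ-injective xs ys e1
  ...   | e3 , e4 = e3 , e4 , e2

module _ {X : Set} {P : Pred X 0ℓ} (P? : Decidable P) where
  indicator : X → ℕ
  indicator x = length (filter P? (x ∷ []))

  filter-length-∷ : ∀ x xs → length (filter P? (x ∷ xs)) ≡ indicator x + length (filter P? xs)
  filter-length-∷ x xs = trans (cong length (filter-++ P? (x ∷ []) xs)) (length-++ (filter P? (x ∷ [])))

  filter-length-↭ : ∀ {xs ys : List X} → xs ↭ ys → length (filter P? xs) ≡ length (filter P? ys)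
  filter-length-↭ p = ↭-length (filter-↭ P? p)

  filter-witness : ∀ xs → 0 < length (filter P? xs) → Σ[ x ∈ X ] (x ∈ xs × P x)
  filter-witness xs p with filter P? xs in eq
  ... | [] = ⊥-elim (<-irrefl refl p)
  ... | z ∷ _ = z , ∈-filter⁻ P? (subst (z ∈_) (sym eq) (here refl))

module _ {n : ℕ} where
  _∈?_ : (x : Fin n) (xs : List (Fin n)) → Dec (x ∈ xs)
  x ∈? xs = any? (x ≟_) xs

-- Edge multisets.  A list of edges is compared with another one only through
-- the multiplicities mult u v of the pairs {u,v}; δ u v e is the contribution
-- of the single edge e.
module _ {n : ℕ} where
  δ : Fin n → Fin n → Edge n → ℕ
  δ u v e with sameEdge? u v e
  ... | yes _ = 1
  ... | no _ = 0

  mult-∷ : ∀ (u v : Fin n) e es → mult u v (e ∷ es) ≡ δ u v e + mult u v es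
  mult-∷ u v e es with sameEdge? u v e
  ... | yes p = cong length (filter-accept (sameEdge? u v) p)
  ... | no p = cong length (filter-reject (sameEdge? u v) p)

  mult-++ : ∀ (u v : Fin n) (xs ys : List (Edge n)) → mult u v (xs ++ ys) ≡ mult u v xs + mult u v ys
  mult-++ u v xs ys = trans (cong length (filter-++ (sameEdge? u v) xs ys)) (length-++ (filter (sameEdge? u v) xs))

  δ-yes : ∀ {u v : Fin n} {e} → SameEdge u v e → δ u v e ≡ 1
  δ-yes {u} {v} {e} p with sameEdge? u v e
  ... | yes _ = refl
  ... | no q = ⊥-elim (q p)

  δ-no : ∀ {u v : Fin n} {e} → ¬ SameEdge u v e → δ u v e ≡ 0
  δ-no {u} {v} {e} p with sameEdge? u v e
  ... | yes q = ⊥-elim (p q)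
  ... | no q = refl

  sameEdge-swap : ∀ {u v a b : Fin n} → SameEdge u v (a , b) → SameEdge u v (b , a)
  sameEdge-swap (inj₁ (p , q)) = inj₂ (q , p)
  sameEdge-swap (inj₂ (p , q)) = inj₁ (q , p)

  δ-flip : ∀ (u v a b : Fin n) → δ u v (a , b) ≡ δ u v (b , a)
  δ-flip u v a b with sameEdge? u v (a , b)
  ... | yes p = sym (δ-yes (sameEdge-swap p))
  ... | no p = sym (δ-no (λ q → p (sameEdge-swap q)))

  infix 4 _≋_
  record _≋_ (xs ys : List (Edge n)) : Set where
    constructor mk≋
    field run : ∀ (u v : Fin n) → mult u v xs ≡ mult u v ys
  open _≋_ public

  ≋-refl : ∀ {xs : List (Edge n)} → xs ≋ xs
  ≋-refl = mk≋ λ u v → refl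
  ≋-sym : ∀ {xs ys : List (Edge n)} → xs ≋ ys → ys ≋ xs
  ≋-sym p = mk≋ λ u v → sym (run p u v)
  ≋-trans : ∀ {xs ys zs : List (Edge n)} → xs ≋ ys → ys ≋ zs → xs ≋ zs
  ≋-trans p q = mk≋ λ u v → trans (run p u v) (run q u v)
  ≋-≡ : ∀ {xs ys : List (Edge n)} → xs ≡ ys → xs ≋ ys
  ≋-≡ refl = mk≋ λ u v → refl
  ++-cong : ∀ {xs ys zs ws : List (Edge n)} → xs ≋ ys → zs ≋ ws → xs ++ zs ≋ ys ++ ws
  ++-cong {xs} {ys} {zs} {ws} p q = mk≋ λ u v → trans (mult-++ u v xs zs) (trans (cong₂ _+_ (run p u v) (run q u v)) (sym (mult-++ u v ys ws)))
  ++-comm≋ : ∀ (xs ys : List (Edge n)) → xs ++ ys ≋ ys ++ xs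
  ++-comm≋ xs ys = mk≋ λ u v → trans (mult-++ u v xs ys) (trans (+-comm (mult u v xs) _) (sym (mult-++ u v ys xs)))
  flip≋ : ∀ (a b : Fin n) → (a , b) ∷ [] ≋ (b , a) ∷ []
  flip≋ a b = mk≋ λ u v → trans (mult-∷ u v (a , b) []) (trans (cong (_+ 0) (δ-flip u v a b)) (sym (mult-∷ u v (b , a) [])))

  ↭⇒≋ : ∀ {xs ys : List (Edge n)} → xs ↭ ys → xs ≋ ys
  ↭⇒≋ p = mk≋ λ u v → filter-length-↭ (sameEdge? u v) p

  mult-interchange : ∀ (a b c d : List (Edge n)) → (a ++ b) ++ (c ++ d) ≋ (a ++ c) ++ (b ++ d)
  mult-interchange a b c d = mk≋ λ u v → trans (trans (mult-++ u v (a ++ b) (c ++ d)) (cong₂ _+_ (mult-++ u v a b) (mult-++ u v c d)))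
     (trans (lem (mult u v a) (mult u v b) (mult u v c) (mult u v d))
       (sym (trans (mult-++ u v (a ++ c) (b ++ d)) (cong₂ _+_ (mult-++ u v a c) (mult-++ u v b d)))))
    where
    lem : ∀ a b c d → (a + b) + (c + d) ≡ (a + c) + (b + d)
    lem = solve-∀

  expand : ∀ (u v : Fin n) x P y z w → mult u v ((x ∷ (P ++ y ∷ [])) ++ z ∷ w ∷ [])
            ≡ (δ u v x + (mult u v P + (δ u v y + 0))) + (δ u v z + (δ u v w + 0))
  expand u v x P y z w = trans (mult-++ u v (x ∷ (P ++ y ∷ [])) (z ∷ w ∷ []))
    (cong₂ _+_ (trans (mult-∷ u v x _) (cong (δ u v x +_) (trans (mult-++ u v P (y ∷ [])) (cong (mult u v P +_) (mult-∷ u v y [])))))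
               (trans (mult-∷ u v z _) (cong (δ u v z +_) (mult-∷ u v w []))))

  swapEnds≋ : ∀ (s s' t t' a L : Fin n) P →
       ((s' , a) ∷ (P ++ (L , t') ∷ [])) ++ (s , a) ∷ (t , L) ∷ [] ≋ ((s , a) ∷ (P ++ (L , t) ∷ [])) ++ (s' , a) ∷ (t' , L) ∷ []
  swapEnds≋ s s' t t' a L P = mk≋ λ u v → trans (expand u v (s' , a) P (L , t') (s , a) (t , L))
      (trans (cong₂ (λ x y → (δ u v (s' , a) + (mult u v P + (x + 0))) + (δ u v (s , a) + (y + 0))) (δ-flip u v L t') (δ-flip u v t L))
      (trans (lem (δ u v (s' , a)) (mult u v P) (δ u v (t' , L)) (δ u v (s , a)) (δ u v (L , t)))
        (sym (expand u v (s , a) P (L , t) (s' , a) (t' , L)))))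
    where
    lem : ∀ a p b c d → (a + (p + (b + 0))) + (c + (d + 0)) ≡ (c + (p + (d + 0))) + (a + (b + 0))
    lem = solve-∀

  δ0x : ∀ {x y p q : Fin n} → p ≢ x → q ≢ x → δ x y (p , q) ≡ 0
  δ0x px qx = δ-no λ { (inj₁ (a , _)) → px a ; (inj₂ (_ , b)) → qx b }
  δ0y : ∀ {x y p q : Fin n} → p ≢ y → q ≢ y → δ x y (p , q) ≡ 0
  δ0y py qy = δ-no λ { (inj₁ (_ , b)) → qy b ; (inj₂ (a , _)) → py a }
  δ11 : ∀ {x y : Fin n} → δ x y (x , y) ≡ 1
  δ11 = δ-yes (inj₁ (refl , refl))

  -- mult′ is mult computed by structural recursion, so that the multiplicities
  -- of explicit edge lists reduce by rewriting.
  mult′ : Fin n → Fin n → List (Edge n) → ℕ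
  mult′ u v [] = 0
  mult′ u v (e ∷ es) = δ u v e + mult′ u v es
  mult≡mult′ : ∀ u v es → mult u v es ≡ mult′ u v es
  mult≡mult′ u v [] = refl
  mult≡mult′ u v (e ∷ es) = trans (mult-∷ u v e es) (cong (δ u v e +_) (mult≡mult′ u v es))
  mult′-++ : ∀ u v (xs ys : List (Edge n)) → mult′ u v (xs ++ ys) ≡ mult′ u v xs + mult′ u v ys
  mult′-++ u v [] ys = refl
  mult′-++ u v (x ∷ xs) ys = trans (cong (δ u v x +_) (mult′-++ u v xs ys)) (sym (+-assoc (δ u v x) _ _))
  mult′-++₃ : ∀ (x y : Fin n) A B C → mult′ x y ((A ++ B) ++ C) ≡ (mult′ x y A + mult′ x y B) + mult′ x y C
  mult′-++₃ x y A B C = trans (mult′-++ x y (A ++ B) C) (cong (_+ mult′ x y C) (mult′-++ x y A B))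
  ≋-by-mult′ : ∀ {xs ys : List (Edge n)} → (∀ u v → mult′ u v xs ≡ mult′ u v ys) → xs ≋ ys
  ≋-by-mult′ {xs} {ys} h = mk≋ λ u v → trans (mult≡mult′ u v xs) (trans (h u v) (sym (mult≡mult′ u v ys)))

  ≋-transfer : ∀ {P P' S S̄ N T : List (Edge n)} → P' ++ S ≋ P ++ S̄ → S ++ N ≋ S̄ ++ T → P' ++ T ≋ P ++ N
  ≋-transfer {P} {P'} {S} {S̄} {N} {T} e1 e2 = mk≋ λ u v → trans (mult-++ u v P' T)
      (trans (cancel (mult u v P) (mult u v P') (mult u v S) (mult u v S̄) (mult u v N) (mult u v T)
        (trans (sym (mult-++ u v P' S)) (trans (run e1 u v) (mult-++ u v P S̄)))
        (trans (sym (mult-++ u v S N)) (trans (run e2 u v) (mult-++ u v S̄ T))))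
      (sym (mult-++ u v P N)))
    where
    cancel : ∀ p p' a b c d → p' + a ≡ p + b → a + c ≡ b + d → p' + d ≡ p + c
    cancel p p' a b c d h1 h2 = +-cancelʳ-≡ b (p' + d) (p + c) (trans (l1 p' d b) (trans (cong (p' +_) (sym h2)) (trans (l2 p' a c) (trans (cong (_+ c) h1) (l3 p b c)))))
      where
      l1 : ∀ p' d b → p' + d + b ≡ p' + (b + d)
      l1 = solve-∀
      l2 : ∀ p' a c → p' + (a + c) ≡ p' + a + c
      l2 = solve-∀
      l3 : ∀ p b c → p + b + c ≡ p + c + b
      l3 = solve-∀

module _ {n : ℕ} where
  pathEdges : List (Fin n) → List (Edge n)
  pathEdges [] = []
  pathEdges (x ∷ []) = []
  pathEdges (x ∷ y ∷ r) = (x , y) ∷ pathEdges (y ∷ r)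

  closeEdges-path : ∀ (f : Fin n) xs → closeEdges f xs ≡ pathEdges (xs ++ f ∷ [])
  closeEdges-path f [] = refl
  closeEdges-path f (x ∷ []) = refl
  closeEdges-path f (x ∷ y ∷ r) = cong ((x , y) ∷_) (closeEdges-path f (y ∷ r))

  cycleEdges-path : ∀ (x : Fin n) xs → cycleEdges (x ∷ xs) ≡ pathEdges (x ∷ xs ++ x ∷ [])
  cycleEdges-path x xs = closeEdges-path x (x ∷ xs)

  pathEdges-++ : ∀ (xs : List (Fin n)) y ys → pathEdges (xs ++ y ∷ ys) ≡ pathEdges (xs ++ y ∷ []) ++ pathEdges (y ∷ ys)
  pathEdges-++ [] y ys = refl
  pathEdges-++ (x ∷ []) y ys = refl
  pathEdges-++ (x ∷ x' ∷ xs) y ys = cong ((x , x') ∷_) (pathEdges-++ (x' ∷ xs) y ys)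

  cycleEdges-split : ∀ (x : Fin n) xs y ys → cycleEdges (x ∷ xs ++ y ∷ ys) ≡ pathEdges (x ∷ xs ++ y ∷ []) ++ pathEdges (y ∷ ys ++ x ∷ [])
  cycleEdges-split x xs y ys = begin
      cycleEdges (x ∷ xs ++ y ∷ ys)
    ≡⟨ cycleEdges-path x (xs ++ y ∷ ys) ⟩
      pathEdges ((x ∷ xs ++ y ∷ ys) ++ x ∷ [])
    ≡⟨ cong pathEdges (++-assoc (x ∷ xs) (y ∷ ys) (x ∷ [])) ⟩
      pathEdges ((x ∷ xs) ++ y ∷ (ys ++ x ∷ []))
    ≡⟨ pathEdges-++ (x ∷ xs) y (ys ++ x ∷ []) ⟩
      pathEdges (x ∷ xs ++ y ∷ []) ++ pathEdges (y ∷ ys ++ x ∷ [])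
    ∎
    where open ≡-Reasoning

  cycleEdges-rotate : ∀ (xs ys : List (Fin n)) → cycleEdges (xs ++ ys) ≋ cycleEdges (ys ++ xs)
  cycleEdges-rotate [] ys = ≋-≡ (cong cycleEdges (sym (++-identityʳ ys)))
  cycleEdges-rotate (x ∷ xs) [] = ≋-≡ (cong cycleEdges (++-identityʳ (x ∷ xs)))
  cycleEdges-rotate (x ∷ xs) (y ∷ ys) = ≋-trans (≋-≡ (cycleEdges-split x xs y ys))
     (≋-trans (++-comm≋ (pathEdges (x ∷ xs ++ y ∷ [])) (pathEdges (y ∷ ys ++ x ∷ [])))
       (≋-≡ (sym (cycleEdges-split y ys x xs))))

  pathEdges-snoc₂ : ∀ (zs : List (Fin n)) y x → pathEdges (zs ++ y ∷ x ∷ []) ≡ pathEdges (zs ++ y ∷ []) ++ (y , x) ∷ []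
  pathEdges-snoc₂ zs y x = pathEdges-++ zs y (x ∷ [])

  pathEdges-reverse : ∀ (xs : List (Fin n)) → pathEdges (reverse xs) ≋ pathEdges xs
  pathEdges-reverse [] = ≋-refl
  pathEdges-reverse (x ∷ []) = ≋-refl
  pathEdges-reverse (x ∷ y ∷ r) = ≋-trans (≋-≡ eq) (≋-trans (++-cong (pathEdges-reverse (y ∷ r)) (flip≋ y x)) (++-comm≋ (pathEdges (y ∷ r)) ((x , y) ∷ [])))
    where
    open ≡-Reasoning
    eq : pathEdges (reverse (x ∷ y ∷ r)) ≡ pathEdges (reverse (y ∷ r)) ++ (y , x) ∷ []
    eq = begin
        pathEdges (reverse (x ∷ y ∷ r))
      ≡⟨ cong pathEdges (unfold-reverse x (y ∷ r)) ⟩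
        pathEdges (reverse (y ∷ r) ++ x ∷ [])
      ≡⟨ cong (λ z → pathEdges (z ++ x ∷ [])) (unfold-reverse y r) ⟩
        pathEdges ((reverse r ++ y ∷ []) ++ x ∷ [])
      ≡⟨ cong pathEdges (++-assoc (reverse r) (y ∷ []) (x ∷ [])) ⟩
        pathEdges (reverse r ++ y ∷ x ∷ [])
      ≡⟨ pathEdges-snoc₂ (reverse r) y x ⟩
        pathEdges (reverse r ++ y ∷ []) ++ (y , x) ∷ []
      ≡⟨ cong (λ z → pathEdges z ++ (y , x) ∷ []) (sym (unfold-reverse y r)) ⟩
        pathEdges (reverse (y ∷ r)) ++ (y , x) ∷ []
      ∎

  pathEdges-snoc : ∀ (r : Fin n) R z → pathEdges (r ∷ R ++ z ∷ []) ≡ pathEdges (r ∷ R) ++ (lastOf r R , z) ∷ []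
  pathEdges-snoc r [] z = refl
  pathEdges-snoc r (x ∷ R) z = cong ((r , x) ∷_) (pathEdges-snoc x R z)

  pathEdges-avoid : ∀ (x y : Fin n) xs → x ∉ xs → mult x y (pathEdges xs) ≡ 0
  pathEdges-avoid x y [] _ = refl
  pathEdges-avoid x y (a ∷ []) _ = refl
  pathEdges-avoid x y (a ∷ b ∷ r) nx = trans (mult-∷ x y (a , b) (pathEdges (b ∷ r)))
     (cong₂ _+_ (δ-no λ { (inj₁ (p , _)) → nx (here (sym p)) ; (inj₂ (_ , p)) → nx (there (here (sym p))) })
                (pathEdges-avoid x y (b ∷ r) (λ m → nx (there m))))

  cycleEdges-avoid : ∀ (x y : Fin n) Z → x ∉ Z → mult x y (cycleEdges Z) ≡ 0
  cycleEdges-avoid x y [] _ = refl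
  cycleEdges-avoid x y (z ∷ Z) nx = trans (cong (mult x y) (cycleEdges-path z Z)) (pathEdges-avoid x y (z ∷ Z ++ z ∷ [])
     (λ m → nx (h (∈-++⁻ (z ∷ Z) m))))
    where
    h : x ∈ z ∷ Z ⊎ x ∈ z ∷ [] → x ∈ z ∷ Z
    h (inj₁ m) = m
    h (inj₂ (here p)) = here p

  cycleEdges-reverse : ∀ (x : Fin n) xs → cycleEdges (x ∷ reverse xs) ≋ cycleEdges (x ∷ xs)
  cycleEdges-reverse x xs = ≋-trans (≋-≡ (trans (cycleEdges-path x (reverse xs)) (cong pathEdges (sym (reverse-ends x xs x))))) (≋-trans (pathEdges-reverse (x ∷ xs ++ x ∷ [])) (≋-≡ (sym (cycleEdges-path x xs))))

IsCyc : ∀ {n} → List (Fin n) → Set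
IsCyc c = IsCycle (length c) c

-- Flag lists select some entries of a list of links.  For a list split as
-- pre ++ post, takePad/dropPad split the flags accordingly (missing flags
-- count as false).
takePad : ℕ → List Bool → List Bool
takePad zero fs = []
takePad (suc k) [] = false ∷ takePad k []
takePad (suc k) (f ∷ fs) = f ∷ takePad k fs

dropPad : ℕ → List Bool → List Bool
dropPad zero fs = fs
dropPad (suc k) [] = []
dropPad (suc k) (f ∷ fs) = dropPad k fs

flagAt : ∀ {X : Set} → List X → List Bool → List Bool
flagAt pre fs = takePad (length pre) fs ++ true ∷ dropPad (length pre) fs

-- An end (y , c) stands for the edge from y to the pole of
-- colour c (α or β, see Poles below).  opp exchanges the colour, ι is the
-- Kronecker delta on ends and countEnd the number of occurrences.
module _ {n : ℕ} where
  End : Set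
  End = Fin n × Bool

  _≟E_ : (e f : End) → Dec (e ≡ f)
  _≟E_ = PP.≡-dec _≟_ BP._≟_

  ι : End → End → ℕ
  ι e f with e ≟E f
  ... | yes _ = 1
  ... | no _ = 0

  countEnd : End → List End → ℕ
  countEnd e [] = 0
  countEnd e (f ∷ fs) = ι e f + countEnd e fs

  opp : End → End
  opp (y , c) = (y , not c)

  opp-involutive : ∀ e → opp (opp e) ≡ e
  opp-involutive (y , c) = cong (y ,_) (BP.not-involutive c)

  opp-injective : ∀ {e f} → opp e ≡ opp f → e ≡ f
  opp-injective {e} {f} p = trans (sym (opp-involutive e)) (trans (cong opp p) (opp-involutive f))

  ι-yes : ∀ {e f} → e ≡ f → ι e f ≡ 1
  ι-yes {e} {f} p with e ≟E f
  ... | yes _ = refl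
  ... | no q = ⊥-elim (q p)
  ι-no : ∀ {e f} → e ≢ f → ι e f ≡ 0
  ι-no {e} {f} p with e ≟E f
  ... | yes q = ⊥-elim (p q)
  ... | no _ = refl

  ι-opp : ∀ e f → ι (opp e) (opp f) ≡ ι e f
  ι-opp e f with e ≟E f
  ... | yes p = ι-yes (cong opp p)
  ... | no p = ι-no (λ q → p (opp-injective q))

  ι-oppʳ : ∀ e f → ι e (opp f) ≡ ι (opp e) f
  ι-oppʳ e f = trans (sym (ι-opp e (opp f))) (cong (ι (opp e)) (opp-involutive f))

  ι-sym : ∀ e f → ι e f ≡ ι f e
  ι-sym e f with e ≟E f
  ... | yes p = sym (ι-yes (sym p))
  ... | no p = sym (ι-no (λ q → p (sym q)))

  not≢ : ∀ c → not c ≢ c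
  not≢ true ()
  not≢ false ()

  ι-opp-self : ∀ e → ι e (opp e) ≡ 0
  ι-opp-self (y , c) = ι-no (λ q → not≢ c (sym (cong proj₂ q)))

  ιTF : ∀ (y x : Fin n) → ι (y , true) (x , false) ≡ 0
  ιTF y x = ι-no λ ()
  ιne : ∀ {y x : Fin n} (b : Bool) → y ≢ x → ι (y , b) (x , b) ≡ 0
  ιne b yx = ι-no λ q → yx (cong proj₁ q)

  countEnd-++ : ∀ e xs ys → countEnd e (xs ++ ys) ≡ countEnd e xs + countEnd e ys
  countEnd-++ e [] ys = refl
  countEnd-++ e (x ∷ xs) ys = trans (cong (ι e x +_) (countEnd-++ e xs ys)) (sym (+-assoc (ι e x) _ _))

  countEnd-opp : ∀ e xs → countEnd e (map opp xs) ≡ countEnd (opp e) xs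
  countEnd-opp e [] = refl
  countEnd-opp e (x ∷ xs) = cong₂ _+_ (ι-oppʳ e x) (countEnd-opp e xs)

  countEnd-pos⇒∈ : ∀ (e : End) es → 0 < countEnd e es → e ∈ es
  countEnd-pos⇒∈ e [] ()
  countEnd-pos⇒∈ e (f ∷ fs) p = go (e ≟E f)
    where
    go : Dec (e ≡ f) → e ∈ f ∷ fs
    go (yes q) = here q
    go (no q) = there (countEnd-pos⇒∈ e fs (subst (0 <_) (cong (_+ countEnd e fs) (ι-no q)) p))

  countEnd-middle : ∀ (e : End) P f Q → countEnd e (P ++ f ∷ Q) ≡ ι e f + countEnd e (P ++ Q)
  countEnd-middle e P f Q = trans (countEnd-++ e P (f ∷ Q)) (trans (lem (countEnd e P) (ι e f) (countEnd e Q)) (cong (ι e f +_) (sym (countEnd-++ e P Q))))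
    where
    lem : ∀ a b c → a + (b + c) ≡ b + (a + c)
    lem = solve-∀

  ≈E⇒↭ : ∀ (xs ys : List End) → (∀ e → countEnd e xs ≡ countEnd e ys) → xs ↭ ys
  ≈E⇒↭ [] [] h = ↭-refl
  ≈E⇒↭ [] (f ∷ fs) h = ⊥-elim (0≢1+n (trans (h f) (cong (_+ countEnd f fs) (ι-yes refl))))
  ≈E⇒↭ (e ∷ xs) ys h with ∈-∃++ (countEnd-pos⇒∈ e ys (subst (0 <_) (h e) (subst (λ z → 0 < z + countEnd e xs) (sym (ι-yes refl)) (s≤s z≤n))))
  ... | P , Q , refl = ↭-trans (prep e (≈E⇒↭ xs (P ++ Q) h')) (↭-sym (shift e P Q))
    where
    h' : ∀ f → countEnd f xs ≡ countEnd f (P ++ Q)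
    h' f = +-cancelˡ-≡ (ι f e) _ _ (trans (h f) (countEnd-middle f P e Q))

  infix 4 _≈E_
  record _≈E_ (xs ys : List End) : Set where
    constructor mk≈
    field runE : ∀ e → countEnd e xs ≡ countEnd e ys
  open _≈E_ public

  -- A link is a pair of ends that are switched together: the two end edges of
  -- a path between poles.  linkEnds lists all ends, select those of the links
  -- flagged true.
  Link : Set
  Link = End × End

  linkEnds : List Link → List End
  linkEnds [] = []
  linkEnds ((a , b) ∷ us) = a ∷ b ∷ linkEnds us

  select : List Bool → List Link → List End
  select fs [] = []
  select [] (u ∷ us) = []
  select (true ∷ fs) ((a , b) ∷ us) = a ∷ b ∷ select fs us
  select (false ∷ fs) (_ ∷ us) = select fs us

  select-[] : ∀ us → select [] us ≡ []
  select-[] [] = refl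
  select-[] (u ∷ us) = refl

  select-prefix : ∀ pre fs gs rest → select (takePad (length pre) fs ++ gs) (pre ++ rest) ≡ select fs pre ++ select gs rest
  select-prefix [] fs gs rest = refl
  select-prefix (u ∷ pre) [] gs rest = trans (select-prefix pre [] gs rest) (cong (_++ select gs rest) (select-[] pre))
  select-prefix ((a , b) ∷ pre) (true ∷ fs) gs rest = cong (λ z → a ∷ b ∷ z) (select-prefix pre fs gs rest)
  select-prefix (u ∷ pre) (false ∷ fs) gs rest = select-prefix pre fs gs rest

  select-++ : ∀ pre fs post → select fs (pre ++ post) ≡ select fs pre ++ select (dropPad (length pre) fs) post
  select-++ [] fs post = refl
  select-++ (u ∷ pre) [] post = sym (select-[] post)
  select-++ ((a , b) ∷ pre) (true ∷ fs) post = cong (λ z → a ∷ b ∷ z) (select-++ pre fs post)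
  select-++ (u ∷ pre) (false ∷ fs) post = select-++ pre fs post

  linkEnds-++ : ∀ xs ys → linkEnds (xs ++ ys) ≡ linkEnds xs ++ linkEnds ys
  linkEnds-++ [] ys = refl
  linkEnds-++ ((a , b) ∷ xs) ys = cong (λ z → a ∷ b ∷ z) (linkEnds-++ xs ys)

  record LinkAt (s : End) (us : List Link) : Set where
    field
      pre post : List Link
      a b : End
      split : us ≡ pre ++ (a , b) ∷ post
      which : a ≡ s ⊎ b ≡ s

  findLink : ∀ s us → 0 < countEnd s (linkEnds us) → LinkAt s us
  findLink s [] ()
  findLink s ((a , b) ∷ us) p = go (s ≟E a) (s ≟E b)
    where
    go : Dec (s ≡ a) → Dec (s ≡ b) → LinkAt s ((a , b) ∷ us)
    go (yes q) _ = record { pre = [] ; post = us ; a = a ; b = b ; split = refl ; which = inj₁ (sym q) }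
    go (no q) (yes r) = record { pre = [] ; post = us ; a = a ; b = b ; split = refl ; which = inj₂ (sym r) }
    go (no q) (no r) = record { pre = (a , b) ∷ F.pre ; post = F.post ; a = F.a ; b = F.b ; split = cong ((a , b) ∷_) F.split ; which = F.which }
      where
      p' : 0 < countEnd s (linkEnds us)
      p' = subst (0 <_) (cong₂ (λ x y → x + (y + countEnd s (linkEnds us))) (ι-no q) (ι-no r)) p
      module F = LinkAt (findLink s us p')

  linkEnds-middle : ∀ e pre a b post → countEnd e (linkEnds (pre ++ (a , b) ∷ post)) ≡ ι e a + (ι e b + countEnd e (linkEnds (pre ++ post)))
  linkEnds-middle e pre a b post = begin
      countEnd e (linkEnds (pre ++ (a , b) ∷ post))
    ≡⟨ cong (countEnd e) (linkEnds-++ pre ((a , b) ∷ post)) ⟩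
      countEnd e (linkEnds pre ++ a ∷ b ∷ linkEnds post)
    ≡⟨ countEnd-++ e (linkEnds pre) (a ∷ b ∷ linkEnds post) ⟩
      countEnd e (linkEnds pre) + (ι e a + (ι e b + countEnd e (linkEnds post)))
    ≡⟨ lem (countEnd e (linkEnds pre)) (ι e a) (ι e b) (countEnd e (linkEnds post)) ⟩
      ι e a + (ι e b + (countEnd e (linkEnds pre) + countEnd e (linkEnds post)))
    ≡⟨ cong (λ z → ι e a + (ι e b + z)) (sym (trans (cong (countEnd e) (linkEnds-++ pre post)) (countEnd-++ e (linkEnds pre) (linkEnds post)))) ⟩
      ι e a + (ι e b + countEnd e (linkEnds (pre ++ post)))
    ∎
    where
    open ≡-Reasoning
    lem : ∀ p x y q → p + (x + (y + q)) ≡ x + (y + (p + q))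
    lem = solve-∀

  select-insert : ∀ pre a b post fs → select (flagAt pre fs) (pre ++ (a , b) ∷ post)
                                ≡ select fs pre ++ a ∷ b ∷ select (dropPad (length pre) fs) post
  select-insert pre a b post fs = select-prefix pre fs (true ∷ dropPad (length pre) fs) ((a , b) ∷ post)

  select-middle : ∀ e pre a b post fs → countEnd e (select (flagAt pre fs) (pre ++ (a , b) ∷ post))
             ≡ ι e a + (ι e b + countEnd e (select fs (pre ++ post)))
  select-middle e pre a b post fs = begin
       countEnd e (select (flagAt pre fs) (pre ++ (a , b) ∷ post))
     ≡⟨ cong (countEnd e) (select-insert pre a b post fs) ⟩
       countEnd e (select fs pre ++ a ∷ b ∷ select (dropPad (length pre) fs) post)
     ≡⟨ countEnd-++ e (select fs pre) _ ⟩
       countEnd e (select fs pre) + (ι e a + (ι e b + countEnd e (select (dropPad (length pre) fs) post)))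
     ≡⟨ lem (countEnd e (select fs pre)) (ι e a) (ι e b) _ ⟩
       ι e a + (ι e b + (countEnd e (select fs pre) + countEnd e (select (dropPad (length pre) fs) post)))
     ≡⟨ cong (λ z → ι e a + (ι e b + z)) (sym (trans (cong (countEnd e) (select-++ pre fs post)) (countEnd-++ e (select fs pre) _))) ⟩
       ι e a + (ι e b + countEnd e (select fs (pre ++ post)))
     ∎
    where
    open ≡-Reasoning
    lem : ∀ p x y q → p + (x + (y + q)) ≡ x + (y + (p + q))
    lem = solve-∀

  -- Outcome of following a chain of links from the end s: the selected ends
  -- together with opp s and the terminal end opp t are exchanged with their
  -- opposites (a switch that changes the ends only at s and t), and t is in
  -- excess over opp t once opp s is added.
  ChainSwitch : End → List Link → Set
  ChainSwitch s us = Σ[ fs ∈ List Bool ] Σ[ t ∈ End ]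
     (countEnd (opp t) (opp s ∷ linkEnds us) < countEnd t (opp s ∷ linkEnds us)) ×
     (select fs us ++ opp s ∷ opp t ∷ [] ≈E map opp (select fs us) ++ s ∷ t ∷ [])

  countEnd-snoc₂ : ∀ e xs x y → countEnd e (xs ++ x ∷ y ∷ []) ≡ countEnd e xs + (ι e x + (ι e y + 0))
  countEnd-snoc₂ e xs x y = countEnd-++ e xs (x ∷ y ∷ [])

  Splits : End → End → List End → List End → Set
  Splits s t S S' = ∀ e → countEnd e S ≡ ι e s + (ι e t + countEnd e S')

  otherEnd : ∀ {s a b} → a ≡ s ⊎ b ≡ s → Σ[ t₀ ∈ End ] (∀ e X → ι e a + (ι e b + X) ≡ ι e s + (ι e t₀ + X))
  otherEnd {b = b} (inj₁ refl) = b , λ e X → refl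
  otherEnd {a = a} (inj₂ refl) = a , λ e X → +-exchange (ι e a) _ X
    where
    +-exchange : ∀ x y z → x + (y + z) ≡ y + (x + z)
    +-exchange = solve-∀

  splitsAt : ∀ {s a b t₀} pre post → (∀ e X → ι e a + (ι e b + X) ≡ ι e s + (ι e t₀ + X)) →
    Splits s t₀ (linkEnds (pre ++ (a , b) ∷ post)) (linkEnds (pre ++ post))
  splitsAt {a = a} {b} pre post link e = trans (linkEnds-middle e pre a b post) (link e _)

  selectsAt : ∀ {s a b t₀} pre post → (∀ e X → ι e a + (ι e b + X) ≡ ι e s + (ι e t₀ + X)) →
    ∀ fs → Splits s t₀ (select (flagAt pre fs) (pre ++ (a , b) ∷ post)) (select fs (pre ++ post))
  selectsAt {a = a} {b} pre post link fs e = trans (select-middle e pre a b post fs) (link e _)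

  closeChain : ∀ s t S → Splits s t S [] → S ++ opp s ∷ opp t ∷ [] ≈E map opp S ++ s ∷ t ∷ []
  closeChain s t S split = mk≈ λ e → begin
      countEnd e (S ++ opp s ∷ opp t ∷ [])
    ≡⟨ countEnd-snoc₂ e S (opp s) (opp t) ⟩
      countEnd e S + (ι e (opp s) + (ι e (opp t) + 0))
    ≡⟨ cong (_+ (ι e (opp s) + (ι e (opp t) + 0))) (split e) ⟩
      (ι e s + (ι e t + 0)) + (ι e (opp s) + (ι e (opp t) + 0))
    ≡⟨ +-comm (ι e s + (ι e t + 0)) _ ⟩
      (ι e (opp s) + (ι e (opp t) + 0)) + (ι e s + (ι e t + 0))
    ≡⟨ cong (_+ (ι e s + (ι e t + 0))) (sym (trans (countEnd-opp e S) (trans (split (opp e))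
          (cong₂ (λ x y → x + (y + 0)) (sym (ι-oppʳ e s)) (sym (ι-oppʳ e t)))))) ⟩
      countEnd e (map opp S) + (ι e s + (ι e t + 0))
    ≡⟨ sym (countEnd-snoc₂ e (map opp S) s t) ⟩
      countEnd e (map opp S ++ s ∷ t ∷ [])
    ∎
    where open ≡-Reasoning

  extendChain : ∀ s t₀ t S S' → Splits s t₀ S S' →
    S' ++ opp (opp t₀) ∷ opp t ∷ [] ≈E map opp S' ++ opp t₀ ∷ t ∷ [] →
    S ++ opp s ∷ opp t ∷ [] ≈E map opp S ++ s ∷ t ∷ []
  extendChain s t₀ t S S' split chain = mk≈ λ e → begin
      countEnd e (S ++ opp s ∷ opp t ∷ [])
    ≡⟨ countEnd-snoc₂ e S (opp s) (opp t) ⟩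
      countEnd e S + (ι e (opp s) + (ι e (opp t) + 0))
    ≡⟨ cong (_+ (ι e (opp s) + (ι e (opp t) + 0))) (split e) ⟩
      (ι e s + (ι e t₀ + countEnd e S')) + (ι e (opp s) + (ι e (opp t) + 0))
    ≡⟨ rearrange (ι e s) (ι e t₀) (countEnd e S') (ι e (opp s)) (ι e (opp t)) (countEnd (opp e) S') (ι e (opp t₀)) (ι e t) (shorterChain e) ⟩
      (ι e (opp s) + (ι e (opp t₀) + countEnd (opp e) S')) + (ι e s + (ι e t + 0))
    ≡⟨ cong (_+ (ι e s + (ι e t + 0))) (sym (trans (countEnd-opp e S) (trans (split (opp e))
          (cong₂ (λ x y → x + (y + countEnd (opp e) S')) (sym (ι-oppʳ e s)) (sym (ι-oppʳ e t₀)))))) ⟩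
      countEnd e (map opp S) + (ι e s + (ι e t + 0))
    ≡⟨ sym (countEnd-snoc₂ e (map opp S) s t) ⟩
      countEnd e (map opp S ++ s ∷ t ∷ [])
    ∎
    where
    open ≡-Reasoning
    shorterChain : ∀ e → countEnd e S' + (ι e t₀ + (ι e (opp t) + 0)) ≡ countEnd (opp e) S' + (ι e (opp t₀) + (ι e t + 0))
    shorterChain e = trans (cong (λ z → countEnd e S' + (ι e z + (ι e (opp t) + 0))) (sym (opp-involutive t₀)))
               (trans (sym (countEnd-snoc₂ e S' (opp (opp t₀)) (opp t))) (trans (runE chain e)
                 (trans (countEnd-snoc₂ e (map opp S') (opp t₀) t) (cong (_+ (ι e (opp t₀) + (ι e t + 0))) (countEnd-opp e S')))))
    rearrange : ∀ x1 x2 p y1 y2 q z w → p + (x2 + (y2 + 0)) ≡ q + (z + (w + 0)) →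
                (x1 + (x2 + p)) + (y1 + (y2 + 0)) ≡ (y1 + (z + q)) + (x1 + (w + 0))
    rearrange x1 x2 p y1 y2 q z w h = trans (l1 x1 x2 p y1 y2) (trans (cong ((x1 + y1) +_) h) (l2 x1 y1 q z w))
      where
      l1 : ∀ x1 x2 p y1 y2 → (x1 + (x2 + p)) + (y1 + (y2 + 0)) ≡ (x1 + y1) + (p + (x2 + (y2 + 0)))
      l1 = solve-∀
      l2 : ∀ x1 y1 q z w → (x1 + y1) + (q + (z + (w + 0))) ≡ (y1 + (z + q)) + (x1 + (w + 0))
      l2 = solve-∀

  passExcess : ∀ s t₀ E E' → Splits s t₀ E E' →
    ¬ (countEnd (opp t₀) (opp s ∷ E) < countEnd t₀ (opp s ∷ E)) →
    countEnd (opp (opp t₀)) E' < countEnd (opp t₀) E'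
  passExcess s t₀ E E' split short =
    subst (λ z → countEnd z E' < countEnd (opp t₀) E') (sym (opp-involutive t₀))
      (cancel A B (countEnd t₀ E') (countEnd (opp t₀) E') (λ q → short (subst₂ _<_ (sym at-opp-t₀) (sym at-t₀) q)))
    where
    A = ι t₀ (opp s)
    B = ι t₀ s
    at-t₀ : countEnd t₀ (opp s ∷ E) ≡ A + (B + (1 + countEnd t₀ E'))
    at-t₀ = cong (A +_) (trans (split t₀) (cong (λ z → B + (z + countEnd t₀ E')) (ι-yes refl)))
    at-opp-t₀ : countEnd (opp t₀) (opp s ∷ E) ≡ B + (A + (0 + countEnd (opp t₀) E'))
    at-opp-t₀ = cong₂ _+_ (ι-opp t₀ s) (trans (split (opp t₀))
      (cong₂ (λ x y → x + (y + countEnd (opp t₀) E')) (sym (ι-oppʳ t₀ s)) (trans (ι-sym (opp t₀) t₀) (ι-opp-self t₀))))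
    cancel : ∀ A B x y → ¬ (B + (A + (0 + y)) < A + (B + (1 + x))) → x < y
    cancel A B x y h = +-cancelˡ-≤ (A + B) _ _ (subst₂ _≤_ (e1 A B x) (e2 A B y) (≮⇒≥ h))
      where
      e1 : ∀ A B x → A + (B + (1 + x)) ≡ A + B + suc x
      e1 = solve-∀
      e2 : ∀ A B y → B + (A + (0 + y)) ≡ A + B + y
      e2 = solve-∀

  liftExcess : ∀ s t₀ t E E' → Splits s t₀ E E' →
    countEnd (opp t) (opp (opp t₀) ∷ E') < countEnd t (opp (opp t₀) ∷ E') →
    countEnd (opp t) (opp s ∷ E) < countEnd t (opp s ∷ E)
  liftExcess s t₀ t E E' split excess =
    subst₂ _<_ (sym (cong₂ _+_ (ι-opp t s) (trans (split (opp t)) (cong (_+ G (opp t)) (sym (ι-oppʳ t s))))))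
               (sym (cong (ι t (opp s) +_) (split t)))
               (addBoth (ι t (opp s)) (ι t s) (G t) (G (opp t)) excess′)
    where
    G : End → ℕ
    G e = ι e t₀ + countEnd e E'
    excess′ : G (opp t) < G t
    excess′ = subst (λ z → ι (opp t) z + countEnd (opp t) E' < ι t z + countEnd t E') (opp-involutive t₀) excess
    addBoth : ∀ x y g g' → g' < g → y + (x + g') < x + (y + g)
    addBoth x y g g' h = subst₂ _<_ (e x y g') (e' x y g) (+-monoʳ-< (x + y) h)
      where
      e : ∀ x y g → x + y + g ≡ y + (x + g)
      e = solve-∀
      e' : ∀ x y g → x + y + g ≡ x + (y + g)
      e' = solve-∀

  -- If s occurs more often than opp s among the link ends,
  -- flip a link through s; if its other end t₀ is in excess the chain is
  -- closed, otherwise opp t₀ is in excess in the remaining links and the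
  -- chain continues from there.
  chainSwitch : ∀ k us → length us ≤ k → ∀ s → countEnd (opp s) (linkEnds us) < countEnd s (linkEnds us) → ChainSwitch s us
  chainSwitch zero [] len s ()
  chainSwitch (suc k) us len s excess = atLink (findLink s us (≤-<-trans z≤n excess))
    where
    flipLink : ∀ pre post {a b} → length (pre ++ (a , b) ∷ post) ≤ suc k →
               Σ[ t₀ ∈ End ] (∀ e X → ι e a + (ι e b + X) ≡ ι e s + (ι e t₀ + X)) → ChainSwitch s (pre ++ (a , b) ∷ post)
    flipLink pre post {a} {b} len′ (t₀ , link)
      with countEnd (opp t₀) (opp s ∷ linkEnds (pre ++ (a , b) ∷ post)) <? countEnd t₀ (opp s ∷ linkEnds (pre ++ (a , b) ∷ post))
    ... | yes t₀-excess = flagAt pre [] , t₀ , t₀-excess , closeChain s t₀ _ (λ e → trans (selectsAt pre post link [] e)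
                            (cong (λ z → ι e s + (ι e t₀ + countEnd e z)) (select-[] (pre ++ post))))
    ... | no t₀-short with chainSwitch k (pre ++ post) (length-remove pre post len′) (opp t₀) (passExcess s t₀ (linkEnds (pre ++ (a , b) ∷ post)) (linkEnds (pre ++ post)) (splitsAt pre post link) t₀-short)
    ...   | fs , t , t-excess , chain =
      flagAt pre fs , t , liftExcess s t₀ t (linkEnds (pre ++ (a , b) ∷ post)) (linkEnds (pre ++ post)) (splitsAt pre post link) t-excess , extendChain s t₀ t (select (flagAt pre fs) (pre ++ (a , b) ∷ post)) (select fs (pre ++ post)) (selectsAt pre post link fs) chain
    atLink : LinkAt s us → ChainSwitch s us
    atLink F = subst (ChainSwitch s) (sym split) (flipLink pre post (subst (λ z → length z ≤ suc k) split len) (otherEnd which))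
      where open LinkAt F

module Poles {n : ℕ} (α β : Fin n) (α≢β : α ≢ β) where
  pole : Bool → Fin n
  pole true = α
  pole false = β

  pole-injective : ∀ {c d} → pole c ≡ pole d → c ≡ d
  pole-injective {true} {true} _ = refl
  pole-injective {true} {false} p = ⊥-elim (α≢β p)
  pole-injective {false} {true} p = ⊥-elim (α≢β (sym p))
  pole-injective {false} {false} _ = refl

  Off : Fin n → Set
  Off z = z ≢ α × z ≢ β

  off≢pole : ∀ {z} → Off z → ∀ c → z ≢ pole c
  off≢pole (p , q) true = p
  off≢pole (p , q) false = q

  endEdge : End → Edge n
  endEdge (y , c) = (pole c , y)

  endEdges : List End → List (Edge n)
  endEdges = map endEdge

  δ-endEdge : ∀ y c z c0 → Off z → δ (pole c) y (pole c0 , z) ≡ ι (y , c) (z , c0)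
  δ-endEdge y c z c0 gz = go ((y , c) ≟E (z , c0))
    where
    go : Dec ((y , c) ≡ (z , c0)) → δ (pole c) y (pole c0 , z) ≡ ι (y , c) (z , c0)
    go (yes refl) = trans (δ-yes (inj₁ (refl , refl))) (sym (ι-yes refl))
    go (no q) = trans (δ-no h) (sym (ι-no q))
      where
      h : ¬ SameEdge (pole c) y (pole c0 , z)
      h (inj₁ (p1 , p2)) = q (cong₂ _,_ (sym p2) (sym (pole-injective p1)))
      h (inj₂ (_ , p2)) = off≢pole gz c p2

  δ-endEdgeʳ : ∀ y c z c0 → Off z → δ (pole c) y (z , pole c0) ≡ ι (y , c) (z , c0)
  δ-endEdgeʳ y c z c0 gz = trans (δ-flip (pole c) y z (pole c0)) (δ-endEdge y c z c0 gz)

-- A cycle Z is switchable for (α, β) when its edges at the poles are grouped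
-- into links such that, for every selection of links, exchanging the poles on
-- the selected links yields again a cycle (apply) of the same length; cntOK
-- says the links account for all pole edges of Z.
module CycleSwitch {n : ℕ} (α β : Fin n) (α≢β : α ≢ β) where
  open Poles α β α≢β public

  record Switchable (Z : List (Fin n)) : Set where
    field
      us : List Link
      apply : List Bool → List (Fin n)
      ap-len : ∀ fs → length (apply fs) ≡ length Z
      ap-uniq : ∀ fs → Unique (apply fs)
      ap-edges : ∀ fs → cycleEdges (apply fs) ++ endEdges (select fs us) ≋ cycleEdges Z ++ endEdges (map opp (select fs us))
      cntOK : ∀ y → Off y → ∀ c → mult (pole c) y (cycleEdges Z) ≡ countEnd (y , c) (linkEnds us)
      endsOK : All (λ e → Off (proj₁ e)) (linkEnds us)

  switchable-transfer : ∀ {Z Z0} → cycleEdges Z0 ≋ cycleEdges Z → length Z0 ≡ length Z → Switchable Z0 → Switchable Z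
  switchable-transfer e l A = record { us = us ; apply = apply ; ap-len = λ fs → trans (ap-len fs) l ; ap-uniq = ap-uniq
     ; ap-edges = λ fs → ≋-trans (ap-edges fs) (++-cong e ≋-refl)
     ; cntOK = λ y g c → trans (sym (run e (pole c) y)) (cntOK y g c) ; endsOK = endsOK }
    where open Switchable A

  off-of : ∀ {X z} → α ∉ X → β ∉ X → z ∈ X → Off z
  off-of nα nβ m = (λ p → nα (subst (_∈ _) p m)) , (λ p → nβ (subst (_∈ _) p m))

  pole∉ : ∀ {X} → α ∉ X → β ∉ X → ∀ c → pole c ∉ X
  pole∉ nα nβ true = nα
  pole∉ nα nβ false = nβ

  segmentLinks : Bool → List (Fin n) → Bool → List Link
  segmentLinks s [] t = []
  segmentLinks s (a ∷ A) t = ((a , s) , (lastOf a A , t)) ∷ []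

  segmentLinks-off : ∀ s A t → α ∉ A → β ∉ A → All (λ e → Off (proj₁ e)) (linkEnds (segmentLinks s A t))
  segmentLinks-off s [] t _ _ = []
  segmentLinks-off s (a ∷ A) t nα nβ = off-of nα nβ (here refl) ∷ off-of nα nβ (lastOf∈ a A) ∷ []

  pathEdges-segment : ∀ (x : Fin n) a A z → pathEdges (x ∷ (a ∷ A) ++ z ∷ []) ≡ (x , a) ∷ (pathEdges (a ∷ A) ++ (lastOf a A , z) ∷ [])
  pathEdges-segment x a A z = cong ((x , a) ∷_) (pathEdges-snoc a A z)

  segment-count : ∀ s A t → α ∉ A → β ∉ A → ∀ y → Off y → ∀ c →
         mult (pole c) y (pathEdges (pole s ∷ A ++ pole t ∷ [])) ≡ countEnd (y , c) (linkEnds (segmentLinks s A t))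
  segment-count s [] t _ _ y gy c = trans (mult-∷ (pole c) y (pole s , pole t) []) (cong (_+ 0) (δ-no h))
    where h : ¬ SameEdge (pole c) y (pole s , pole t)
          h (inj₁ (_ , p)) = off≢pole gy t (sym p)
          h (inj₂ (p , _)) = off≢pole gy s (sym p)
  segment-count s (a ∷ A) t nα nβ y gy c = begin
      mult (pole c) y (pathEdges (pole s ∷ (a ∷ A) ++ pole t ∷ []))
    ≡⟨ cong (mult (pole c) y) (pathEdges-segment (pole s) a A (pole t)) ⟩
      mult (pole c) y ((pole s , a) ∷ (pathEdges (a ∷ A) ++ (L , pole t) ∷ []))
    ≡⟨ mult-∷ (pole c) y (pole s , a) (pathEdges (a ∷ A) ++ (L , pole t) ∷ []) ⟩
      δ (pole c) y (pole s , a) + mult (pole c) y (pathEdges (a ∷ A) ++ (L , pole t) ∷ [])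
    ≡⟨ cong (δ (pole c) y (pole s , a) +_) (mult-++ (pole c) y (pathEdges (a ∷ A)) _) ⟩
      δ (pole c) y (pole s , a) + (mult (pole c) y (pathEdges (a ∷ A)) + mult (pole c) y ((L , pole t) ∷ []))
    ≡⟨ cong₂ (λ x z → δ (pole c) y (pole s , a) + (x + z)) (pathEdges-avoid (pole c) y (a ∷ A) (pole∉ nα nβ c)) (mult-∷ (pole c) y _ []) ⟩
      δ (pole c) y (pole s , a) + (0 + (δ (pole c) y (L , pole t) + 0))
    ≡⟨ cong₂ (λ x z → x + (0 + (z + 0))) (δ-endEdge y c a s (off-of nα nβ (here refl))) (δ-endEdgeʳ y c L t (off-of nα nβ (lastOf∈ a A))) ⟩
      ι (y , c) (a , s) + (ι (y , c) (L , t) + 0)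
    ∎
    where
    open ≡-Reasoning
    L = lastOf a A

  segment-flip : ∀ s t a A → pathEdges (pole (not s) ∷ (a ∷ A) ++ pole (not t) ∷ []) ++ endEdges ((a , s) ∷ (lastOf a A , t) ∷ [])
                    ≋ pathEdges (pole s ∷ (a ∷ A) ++ pole t ∷ []) ++ endEdges ((a , not s) ∷ (lastOf a A , not t) ∷ [])
  segment-flip s t a A = subst₂ (λ X Y → X ++ endEdges ((a , s) ∷ (lastOf a A , t) ∷ []) ≋ Y ++ endEdges ((a , not s) ∷ (lastOf a A , not t) ∷ []))
                   (sym (pathEdges-segment (pole (not s)) a A (pole (not t)))) (sym (pathEdges-segment (pole s) a A (pole t)))
                   (swapEnds≋ (pole s) (pole (not s)) (pole t) (pole (not t)) a (lastOf a A) (pathEdges (a ∷ A)))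

  oneSwitchPole : ∀ c0 r R → α ∉ r ∷ R → β ∉ r ∷ R → Unique (r ∷ R) → Switchable (pole c0 ∷ r ∷ R)
  oneSwitchPole c0 r R nα nβ u = record
    { us = segmentLinks c0 (r ∷ R) c0
    ; apply = apS
    ; ap-len = λ { [] → refl ; (true ∷ fs) → refl ; (false ∷ fs) → refl }
    ; ap-uniq = λ { [] → u0 ; (true ∷ fs) → uniq-cons (pole∉ nα nβ (not c0)) u ; (false ∷ fs) → u0 }
    ; ap-edges = λ { [] → ≋-refl ; (false ∷ fs) → ≋-refl ;
         (true ∷ fs) → subst₂ (λ X Y → X ++ endEdges ((r , c0) ∷ (lastOf r R , c0) ∷ []) ≋ Y ++ endEdges ((r , not c0) ∷ (lastOf r R , not c0) ∷ []))
                   (sym (cycleEdges-path (pole (not c0)) (r ∷ R))) (sym (cycleEdges-path (pole c0) (r ∷ R))) (segment-flip c0 c0 r R) }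
    ; cntOK = λ y gy c → trans (cong (mult (pole c) y) (cycleEdges-path (pole c0) (r ∷ R))) (segment-count c0 (r ∷ R) c0 nα nβ y gy c)
    ; endsOK = segmentLinks-off c0 (r ∷ R) c0 nα nβ
    }
    where
    apS : List Bool → List (Fin n)
    apS (true ∷ _) = pole (not c0) ∷ r ∷ R
    apS _ = pole c0 ∷ r ∷ R
    u0 = uniq-cons (pole∉ nα nβ c0) u

  noSwitchPole : ∀ Z → α ∉ Z → β ∉ Z → Unique Z → Switchable Z
  noSwitchPole Z nα nβ uZ = record
    { us = [] ; apply = λ _ → Z ; ap-len = λ _ → refl ; ap-uniq = λ _ → uZ
    ; ap-edges = λ fs → ≋-refl ; cntOK = λ y gy c → cycleEdges-avoid (pole c) y Z (pole∉ nα nβ c) ; endsOK = [] }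

  -- The segment between α and β is traversed backwards when its link is
  -- flipped, so that the switched cycle again runs α … β.
  orientSegment : List Bool → List (Fin n) → List (Fin n)
  orientSegment (true ∷ _) A = reverse A
  orientSegment _ A = A

  orientSegment-↭ : ∀ fs A → orientSegment fs A ↭ A
  orientSegment-↭ [] A = ↭-refl
  orientSegment-↭ (true ∷ fs) A = ↭-reverse A
  orientSegment-↭ (false ∷ fs) A = ↭-refl

  segment-reverse : ∀ s A fs → pathEdges (pole s ∷ orientSegment fs A ++ pole (not s) ∷ []) ++ endEdges (select fs (segmentLinks s A (not s)))
                    ≋ pathEdges (pole s ∷ A ++ pole (not s) ∷ []) ++ endEdges (map opp (select fs (segmentLinks s A (not s))))
  segment-reverse s [] [] = ≋-refl
  segment-reverse s [] (true ∷ fs) = ≋-refl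
  segment-reverse s [] (false ∷ fs) = ≋-refl
  segment-reverse s (a ∷ A) [] = ≋-refl
  segment-reverse s (a ∷ A) (false ∷ fs) = ≋-refl
  segment-reverse s (a ∷ A) (true ∷ fs) =
    ≋-trans (++-cong (≋-trans (≋-≡ (cong pathEdges (sym (reverse-ends (pole (not s)) (a ∷ A) (pole s))))) (pathEdges-reverse (pole (not s) ∷ (a ∷ A) ++ pole s ∷ []))) (≋-refl {xs = endEdges ((a , s) ∷ (lastOf a A , not s) ∷ [])}))
      (subst (λ b → pathEdges (pole (not s) ∷ (a ∷ A) ++ pole b ∷ []) ++ endEdges ((a , s) ∷ (lastOf a A , not s) ∷ [])
                    ≋ pathEdges (pole s ∷ (a ∷ A) ++ pole (not s) ∷ []) ++ endEdges ((a , not s) ∷ (lastOf a A , not (not s)) ∷ []))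
             (not-inv s) (segment-flip s (not s) a A))
    where
    not-inv : ∀ b → not (not b) ≡ b
    not-inv true = refl
    not-inv false = refl

  bothSwitchPoles : ∀ A B → Unique (α ∷ A ++ β ∷ B) → α ∉ A → β ∉ A → α ∉ B → β ∉ B → Switchable (α ∷ A ++ β ∷ B)
  bothSwitchPoles A B u nαA nβA nαB nβB = record
    { us = uA ++ uB
    ; apply = apT
    ; ap-len = λ fs → ↭-length (perm fs)
    ; ap-uniq = λ fs → uniq-↭ (↭-sym (perm fs)) u
    ; ap-edges = edges
    ; cntOK = cnt
    ; endsOK = subst (All (λ e → Off (proj₁ e))) (sym (linkEnds-++ uA uB)) (AllP.++⁺ (segmentLinks-off true A false nαA nβA) (segmentLinks-off false B true nαB nβB))
    }
    where
    uA = segmentLinks true A false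
    uB = segmentLinks false B true
    k = length uA
    apT : List Bool → List (Fin n)
    apT fs = α ∷ orientSegment fs A ++ β ∷ orientSegment (dropPad k fs) B
    perm : ∀ fs → apT fs ↭ α ∷ A ++ β ∷ B
    perm fs = prep α (↭-trans (++⁺ʳ (β ∷ orientSegment (dropPad k fs) B) (orientSegment-↭ fs A)) (++⁺ˡ A (prep β (orientSegment-↭ (dropPad k fs) B))))
    edges : ∀ fs → cycleEdges (apT fs) ++ endEdges (select fs (uA ++ uB)) ≋ cycleEdges (α ∷ A ++ β ∷ B) ++ endEdges (map opp (select fs (uA ++ uB)))
    edges fs = ≋-trans (≋-≡ e1) (≋-trans (mult-interchange X* Y* EA EB)
                 (≋-trans (++-cong (segment-reverse true A fs) (segment-reverse false B fs2))
                   (≋-trans (mult-interchange X EA' Y EB') (≋-≡ (sym e2)))))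
      where
      fs2 = dropPad k fs
      X* = pathEdges (α ∷ orientSegment fs A ++ β ∷ [])
      Y* = pathEdges (β ∷ orientSegment fs2 B ++ α ∷ [])
      X = pathEdges (α ∷ A ++ β ∷ [])
      Y = pathEdges (β ∷ B ++ α ∷ [])
      EA = endEdges (select fs uA)
      EB = endEdges (select fs2 uB)
      EA' = endEdges (map opp (select fs uA))
      EB' = endEdges (map opp (select fs2 uB))
      e1 : cycleEdges (apT fs) ++ endEdges (select fs (uA ++ uB)) ≡ (X* ++ Y*) ++ (EA ++ EB)
      e1 = cong₂ _++_ (cycleEdges-split α (orientSegment fs A) β (orientSegment fs2 B)) (trans (cong endEdges (select-++ uA fs uB)) (map-++ endEdge (select fs uA) (select fs2 uB)))
      e2 : cycleEdges (α ∷ A ++ β ∷ B) ++ endEdges (map opp (select fs (uA ++ uB))) ≡ (X ++ Y) ++ (EA' ++ EB')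
      e2 = cong₂ _++_ (cycleEdges-split α A β B) (trans (cong (λ z → endEdges (map opp z)) (select-++ uA fs uB))
              (trans (cong endEdges (map-++ opp (select fs uA) (select fs2 uB))) (map-++ endEdge (map opp (select fs uA)) (map opp (select fs2 uB)))))
    cnt : ∀ y → Off y → ∀ c → mult (pole c) y (cycleEdges (α ∷ A ++ β ∷ B)) ≡ countEnd (y , c) (linkEnds (uA ++ uB))
    cnt y gy c = trans (cong (mult (pole c) y) (cycleEdges-split α A β B))
       (trans (mult-++ (pole c) y (pathEdges (α ∷ A ++ β ∷ [])) (pathEdges (β ∷ B ++ α ∷ [])))
       (trans (cong₂ _+_ (segment-count true A false nαA nβA y gy c) (segment-count false B true nαB nβB y gy c))
       (sym (trans (cong (countEnd (y , c)) (linkEnds-++ uA uB)) (countEnd-++ (y , c) (linkEnds uA) (linkEnds uB))))))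

  switchable-rotate : ∀ (x : Fin n) P Q → Switchable (x ∷ Q ++ P) → Switchable (P ++ x ∷ Q)
  switchable-rotate x P Q A = switchable-transfer (≋-sym (cycleEdges-rotate P (x ∷ Q))) (length-++-comm (x ∷ Q) P) A

  unique-rotate : ∀ (x : Fin n) P Q → Unique (P ++ x ∷ Q) → Unique (x ∷ Q ++ P)
  unique-rotate x P Q u = uniq-↭ (++-comm P (x ∷ Q)) u

  cycleSwitchable : ∀ Z → Unique Z → 2 ≤ length Z → Switchable Z
  cycleSwitchable Z uZ len = caseα (α ∈? Z)
    where
    caseα : Dec (α ∈ Z) → Switchable Z
    caseα (yes m) with ∈-∃++ m
    ... | P , Q , refl = switchable-rotate α P Q (inner (unique-rotate α P Q uZ) (subst (2 ≤_) (length-++-comm P (α ∷ Q)) len))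
      where
      inner : Unique (α ∷ Q ++ P) → 2 ≤ length (α ∷ Q ++ P) → Switchable (α ∷ Q ++ P)
      inner u l = caseβ (β ∈? (Q ++ P))
        where
        caseβ : Dec (β ∈ Q ++ P) → Switchable (α ∷ Q ++ P)
        caseβ (yes mβ) with ∈-∃++ mβ
        ... | A , B , eq = subst (λ R → Switchable (α ∷ R)) (sym eq)
                (bothSwitchPoles A B u' (∉-++ˡ A nα') (∉-++ˡ A nβAB) (λ m' → nα' (∈-++⁺ʳ A (there m'))) (∉-++ʳ A nβAB))
          where
          u' : Unique (α ∷ A ++ β ∷ B)
          u' = subst (λ R → Unique (α ∷ R)) eq u
          nα' : α ∉ A ++ β ∷ B
          nα' = Unique[x∷xs]⇒x∉xs u'
          nβAB : β ∉ A ++ B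
          nβAB = uniq-mid A B (AllPairs.tail u')
        caseβ (no nβ) = single' (Q ++ P) l nβ u
          where
          single' : ∀ R → 2 ≤ length (α ∷ R) → β ∉ R → Unique (α ∷ R) → Switchable (α ∷ R)
          single' [] (s≤s ()) _ _
          single' (r ∷ R) _ nb uu = oneSwitchPole true r R (Unique[x∷xs]⇒x∉xs uu) nb (AllPairs.tail uu)
    caseα (no nα) = caseβ' (β ∈? Z)
      where
      caseβ' : Dec (β ∈ Z) → Switchable Z
      caseβ' (yes m) with ∈-∃++ m
      ... | P , Q , refl = switchable-rotate β P Q (single'' (Q ++ P) (subst (2 ≤_) (length-++-comm P (β ∷ Q)) len)
               (λ m' → nα (∈-resp-↭ (++-comm (β ∷ Q) P) (there m'))) (unique-rotate β P Q uZ))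
        where
        single'' : ∀ R → 2 ≤ length (β ∷ R) → α ∉ R → Unique (β ∷ R) → Switchable (β ∷ R)
        single'' [] (s≤s ()) _ _
        single'' (r ∷ R) _ na uu = oneSwitchPole false r R na (Unique[x∷xs]⇒x∉xs uu) (AllPairs.tail uu)
      caseβ' (no nβ) = noSwitchPole Z nα nβ uZ

module _ {n : ℕ} where

  inc : Fin n → List (Edge n) → ℕ
  inc v es = length (filter (incident? v) es)

  inc-∷ : ∀ v e es → inc v (e ∷ es) ≡ inc v (e ∷ []) + inc v es
  inc-∷ v e es = filter-length-∷ (incident? v) e es

  incI-yes : ∀ {v} e → Incident v e → inc v (e ∷ []) ≡ 1
  incI-yes {v} e p = cong length (filter-accept (incident? v) p)
  incI-no : ∀ {v} e → ¬ Incident v e → inc v (e ∷ []) ≡ 0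
  incI-no {v} e p = cong length (filter-reject (incident? v) p)

  eqD : ∀ {p v : Fin n} → Dec (p ≡ v) → ℕ
  eqD (yes _) = 1
  eqD (no _) = 0

  incI-formula : ∀ (v p q : Fin n) → p ≢ q → (d1 : Dec (p ≡ v)) (d2 : Dec (q ≡ v)) → inc v ((p , q) ∷ []) ≡ eqD d1 + eqD d2
  incI-formula v p q pq (yes a) (yes b) = ⊥-elim (pq (trans a (sym b)))
  incI-formula v p q pq (yes a) (no b) = incI-yes (p , q) (inj₁ a)
  incI-formula v p q pq (no a) (yes b) = incI-yes (p , q) (inj₂ b)
  incI-formula v p q pq (no a) (no b) = incI-no (p , q) λ { (inj₁ x) → a x ; (inj₂ x) → b x }

  incI-flip : ∀ (v p q : Fin n) → inc v ((p , q) ∷ []) ≡ inc v ((q , p) ∷ [])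
  incI-flip v p q with incident? v (p , q)
  ... | yes (inj₁ x) = trans (incI-yes (p , q) (inj₁ x)) (sym (incI-yes (q , p) (inj₂ x)))
  ... | yes (inj₂ x) = trans (incI-yes (p , q) (inj₂ x)) (sym (incI-yes (q , p) (inj₁ x)))
  ... | no x = trans (incI-no (p , q) x) (sym (incI-no (q , p) λ { (inj₁ y) → x (inj₂ y) ; (inj₂ y) → x (inj₁ y) }))

  noInc : ∀ (v y : Fin n) es → inc v es ≡ 0 → mult v y es ≡ 0
  noInc v y [] _ = refl
  noInc v y (e ∷ es) h = trans (mult-∷ v y e es) (cong₂ _+_ (δ-no nS) (noInc v y es h2))
    where
    h' : inc v (e ∷ []) + inc v es ≡ 0
    h' = trans (sym (inc-∷ v e es)) h
    nI : ¬ Incident v e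
    nI i = 1+n≢0 (trans (cong (_+ inc v es) (sym (incI-yes e i))) h')
    nS : ¬ SameEdge v y e
    nS (inj₁ (p , _)) = nI (inj₁ p)
    nS (inj₂ (_ , p)) = nI (inj₂ p)
    h2 : inc v es ≡ 0
    h2 = m+n≡0⇒n≡0 (inc v (e ∷ [])) h'

  inc-↭ : ∀ v {xs ys : List (Edge n)} → xs ↭ ys → inc v xs ≡ inc v ys
  inc-↭ v p = filter-length-↭ (incident? v) p

-- The matching is switchable as well: if α and β are matched to off vertices
-- a and b, the single link ((a,α),(b,β)) may be flipped, replacing αa, βb by
-- βa, αb; the result is again empty resp. a perfect matching.
module MatchingSwitch {n : ℕ} (α β : Fin n) (α≢β : α ≢ β) where
  open Poles α β α≢β

  record MatchingSwitchable (mt : List (Edge n)) : Set where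
    field
      usM : List Link
      applyM : List Bool → List (Edge n)
      apM-edges : ∀ fs → applyM fs ++ endEdges (select fs usM) ≋ mt ++ endEdges (map opp (select fs usM))
      apM-empty : mt ≡ [] → ∀ fs → applyM fs ≡ []
      apM-perf : IsPerfectMatching n mt → ∀ fs → IsPerfectMatching n (applyM fs)
      cntM : ∀ y → Off y → ∀ c → mult (pole c) y mt ≡ countEnd (y , c) (linkEnds usM)
      endsM : All (λ e → Off (proj₁ e)) (linkEnds usM)

  matchingSwitchable-untouched : ∀ mt → (∀ y → Off y → ∀ c → mult (pole c) y mt ≡ 0) → MatchingSwitchable mt
  matchingSwitchable-untouched mt h = record { usM = [] ; applyM = λ _ → mt ; apM-edges = λ _ → ≋-refl ; apM-empty = λ e _ → e
                         ; apM-perf = λ p _ → p ; cntM = h ; endsM = [] }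

  matchingSwitchable-empty : MatchingSwitchable []
  matchingSwitchable-empty = matchingSwitchable-untouched [] (λ _ _ _ → refl)

  swap4 : ∀ (x y z w : Edge n) R → (x ∷ y ∷ R) ++ z ∷ w ∷ [] ≋ (z ∷ w ∷ R) ++ x ∷ y ∷ []
  swap4 x y z w R = mk≋ λ u v → trans (mult-++ u v (x ∷ y ∷ R) (z ∷ w ∷ []))
     (trans (cong₂ _+_ (trans (mult-∷ u v x _) (cong (δ u v x +_) (mult-∷ u v y R))) (trans (mult-∷ u v z _) (cong (δ u v z +_) (mult-∷ u v w []))))
     (trans (lem (δ u v x) (δ u v y) (mult u v R) (δ u v z) (δ u v w))
     (sym (trans (mult-++ u v (z ∷ w ∷ R) (x ∷ y ∷ []))
     (cong₂ _+_ (trans (mult-∷ u v z _) (cong (δ u v z +_) (mult-∷ u v w R))) (trans (mult-∷ u v x _) (cong (δ u v x +_) (mult-∷ u v y []))))))))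
    where
    lem : ∀ a b r c d → (a + (b + r)) + (c + (d + 0)) ≡ (c + (d + r)) + (a + (b + 0))
    lem = solve-∀

  orient : ∀ (x : Fin n) (e : Edge n) → Incident x e → Σ[ a ∈ Fin n ] (e ≡ (x , a) ⊎ e ≡ (a , x))
  orient x (p , q) (inj₁ refl) = q , inj₁ refl
  orient x (p , q) (inj₂ refl) = p , inj₂ refl

  or≋ : ∀ {x a : Fin n} {e} → (e ≡ (x , a) ⊎ e ≡ (a , x)) → e ∷ [] ≋ (x , a) ∷ []
  or≋ (inj₁ refl) = ≋-refl
  or≋ {x} {a} (inj₂ refl) = flip≋ a x

  orInc : ∀ {x a : Fin n} {e} → (e ≡ (x , a) ⊎ e ≡ (a , x)) → ∀ v → inc v (e ∷ []) ≡ inc v ((x , a) ∷ [])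
  orInc (inj₁ refl) v = refl
  orInc {x} {a} (inj₂ refl) v = incI-flip v a x

  orNL : ∀ {x a : Fin n} {e : Edge n} → (e ≡ (x , a) ⊎ e ≡ (a , x)) → proj₁ e ≢ proj₂ e → x ≢ a
  orNL (inj₁ refl) nl = nl
  orNL (inj₂ refl) nl = λ p → nl (sym p)

  orIncA : ∀ {x a v : Fin n} {e : Edge n} → (e ≡ (x , a) ⊎ e ≡ (a , x)) → ¬ Incident v e → a ≢ v
  orIncA (inj₁ refl) ni p = ni (inj₂ p)
  orIncA (inj₂ refl) ni p = ni (inj₁ p)

  orSame : ∀ {x a c y : Fin n} {e : Edge n} → (e ≡ (x , a) ⊎ e ≡ (a , x)) → δ c y e ≡ δ c y (x , a)
  orSame (inj₁ refl) = refl
  orSame {x} {a} {c} {y} (inj₂ refl) = δ-flip c y a x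

  incSplit : ∀ (v : Fin n) (e : Edge n) (R : List (Edge n)) {k} → inc v (e ∷ R) ≡ suc k → inc v (e ∷ []) ≡ 1 → inc v R ≡ k
  incSplit v e R h h1 = suc-injective (trans (cong (_+ inc v R) (sym h1)) (trans (sym (inc-∷ v e R)) h))

  incSplit0 : ∀ (v : Fin n) (e : Edge n) (R : List (Edge n)) {k} → inc v (e ∷ R) ≡ k → inc v (e ∷ []) ≡ 0 → inc v R ≡ k
  incSplit0 v e R h h0 = trans (cong (_+ inc v R) (sym h0)) (trans (sym (inc-∷ v e R)) h)

  matchingSwitchable-joined : ∀ mt e R → mt ↭ e ∷ R → Incident α e → Incident β e → proj₁ e ≢ proj₂ e →
    inc α R ≡ 0 → inc β R ≡ 0 → MatchingSwitchable mt
  matchingSwitchable-joined mt e R perm iα iβ nle incαR incβR = matchingSwitchable-untouched mt untouched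
    where
    incR : ∀ c → inc (pole c) R ≡ 0
    incR true = incαR
    incR false = incβR
    notSame : ∀ y → Off y → ∀ c → ¬ SameEdge (pole c) y e
    notSame y gy c s = bad iα iβ nle (endp s)
      where
      endp : SameEdge (pole c) y e → y ≡ proj₁ e ⊎ y ≡ proj₂ e
      endp (inj₁ (_ , q)) = inj₂ (sym q)
      endp (inj₂ (q , _)) = inj₁ (sym q)
      bad : Incident α e → Incident β e → proj₁ e ≢ proj₂ e → (y ≡ proj₁ e ⊎ y ≡ proj₂ e) → ⊥
      bad (inj₁ a1) _ _ (inj₁ q) = proj₁ gy (trans q a1)
      bad (inj₂ a2) (inj₁ b1) _ (inj₁ q) = proj₂ gy (trans q b1)
      bad (inj₂ a2) (inj₂ b2) _ _ = α≢β (trans (sym a2) b2)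
      bad _ (inj₂ b2) _ (inj₂ q) = proj₂ gy (trans q b2)
      bad (inj₂ a2) (inj₁ b1) _ (inj₂ q) = proj₁ gy (trans q a2)
      bad (inj₁ a1) (inj₁ b1) _ _ = α≢β (trans (sym a1) b1)
    untouched : ∀ y → Off y → ∀ c → mult (pole c) y mt ≡ 0
    untouched y gy c = trans (run (↭⇒≋ perm) (pole c) y) (trans (mult-∷ (pole c) y e R)
                         (cong₂ _+_ (δ-no (notSame y gy c)) (noInc (pole c) y R (incR c))))

  swapped-perfect : ∀ mt R' {e e' a b} → mt ↭ e ∷ e' ∷ R' → (e ≡ (α , a) ⊎ e ≡ (a , α)) → (e' ≡ (β , b) ⊎ e' ≡ (b , β)) →
    Off a → Off b → IsPerfectMatching n mt → IsPerfectMatching n ((β , a) ∷ (α , b) ∷ R')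
  swapped-perfect mt R' {e} {e'} {a} {b} perm ore ore' (a≢α , a≢β) (b≢α , b≢β) (nl , inc1) =
    ((λ q → a≢β (sym q)) ∷ (λ q → b≢α (sym q)) ∷ nlR') , incOne
    where
    nlR' : All (λ e → proj₁ e ≢ proj₂ e) R'
    nlR' with All-resp-↭ perm nl
    ... | _ ∷ _ ∷ r = r
    incOne : ∀ v → inc v ((β , a) ∷ (α , b) ∷ R') ≡ 1
    incOne v = trans (inc-∷ v (β , a) _) (trans (cong (inc v ((β , a) ∷ []) +_) (inc-∷ v (α , b) R'))
              (trans (cong₂ (λ x y → x + (y + inc v R')) (incI-formula v β a (λ q → a≢β (sym q)) (β ≟ v) (a ≟ v)) (incI-formula v α b (λ q → b≢α (sym q)) (α ≟ v) (b ≟ v)))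
              (trans (lem (eqD (β ≟ v)) (eqD (a ≟ v)) (eqD (α ≟ v)) (eqD (b ≟ v)) (inc v R'))
              (trans (sym (cong₂ (λ x y → x + (y + inc v R')) (trans (orInc ore v) (incI-formula v α a (λ q → a≢α (sym q)) (α ≟ v) (a ≟ v)))
                                                               (trans (orInc ore' v) (incI-formula v β b (λ q → b≢β (sym q)) (β ≟ v) (b ≟ v)))))
              (trans (sym (trans (inc-∷ v e _) (cong (inc v (e ∷ []) +_) (inc-∷ v e' R')))) (trans (sym (inc-↭ v perm)) (inc1 v)))))))
      where
      lem : ∀ x y z w r → (x + y) + ((z + w) + r) ≡ (z + y) + ((x + w) + r)
      lem = solve-∀

  matchingSwitchable-separate : ∀ mt R' {e e' a b} → mt ↭ e ∷ e' ∷ R' → (e ≡ (α , a) ⊎ e ≡ (a , α)) → (e' ≡ (β , b) ⊎ e' ≡ (b , β)) →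
    Off a → Off b → inc α R' ≡ 0 → inc β R' ≡ 0 → MatchingSwitchable mt
  matchingSwitchable-separate mt R' {e} {e'} {a} {b} perm ore ore' offa offb incαR' incβR' = record
    { usM = link ∷ []
    ; applyM = apM
    ; apM-edges = edges
    ; apM-empty = λ eq → ⊥-elim (nonempty eq)
    ; apM-perf = perf
    ; cntM = cntm
    ; endsM = offa ∷ offb ∷ []
    }
    where
    link : Link
    link = ((a , true) , (b , false))
    nonempty : mt ≢ []
    nonempty refl with ↭-length perm
    ... | ()
    apM : List Bool → List (Edge n)
    apM (true ∷ _) = (β , a) ∷ (α , b) ∷ R'
    apM _ = mt
    mt≋ : mt ≋ (α , a) ∷ (β , b) ∷ R'
    mt≋ = ≋-trans (↭⇒≋ perm) (++-cong (or≋ ore) (++-cong (or≋ ore') (≋-refl {xs = R'})))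
    edges : ∀ fs → apM fs ++ endEdges (select fs (link ∷ [])) ≋ mt ++ endEdges (map opp (select fs (link ∷ [])))
    edges [] = ≋-refl
    edges (false ∷ fs) = ≋-refl
    edges (true ∷ fs) = ≋-trans (swap4 (β , a) (α , b) (α , a) (β , b) R') (≋-sym (++-cong mt≋ (≋-refl {xs = (β , a) ∷ (α , b) ∷ []})))
    incR' : ∀ c → inc (pole c) R' ≡ 0
    incR' true = incαR'
    incR' false = incβR'
    cntm : ∀ y → Off y → ∀ c → mult (pole c) y mt ≡ countEnd (y , c) (linkEnds (link ∷ []))
    cntm y gy c = trans (run (↭⇒≋ perm) (pole c) y) (trans (mult-∷ (pole c) y e (e' ∷ R'))
       (cong₂ _+_ (trans (orSame ore) (δ-endEdge y c a true offa))
                  (trans (mult-∷ (pole c) y e' R') (cong₂ _+_ (trans (orSame ore') (δ-endEdge y c b false offb)) (noInc (pole c) y R' (incR' c))))))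
    perf : IsPerfectMatching n mt → ∀ fs → IsPerfectMatching n (apM fs)
    perf p [] = p
    perf p (false ∷ fs) = p
    perf p (true ∷ fs) = swapped-perfect mt R' perm ore ore' offa offb p

  matchingSwitchable-perfect : ∀ mt → IsPerfectMatching n mt → MatchingSwitchable mt
  matchingSwitchable-perfect mt (nl , inc1) with filter-witness (incident? α) mt (subst (0 <_) (sym (inc1 α)) (s≤s z≤n))
  ... | e , e∈mt , iα with ∈-∃++ e∈mt
  ...   | A , B , refl = atβ (incident? β e)
    where
    R = A ++ B
    perm1 : A ++ e ∷ B ↭ e ∷ R
    perm1 = shift e A B
    nle : proj₁ e ≢ proj₂ e
    nle = All-lookup nl e∈mt
    incαR : inc α R ≡ 0
    incαR = incSplit α e R (trans (sym (inc-↭ α perm1)) (inc1 α)) (incI-yes e iα)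
    incβ1 : inc β (e ∷ R) ≡ 1
    incβ1 = trans (sym (inc-↭ β perm1)) (inc1 β)
    atβ : Dec (Incident β e) → MatchingSwitchable (A ++ e ∷ B)
    atβ (yes iβ) = matchingSwitchable-joined _ e R perm1 iα iβ nle incαR (incSplit β e R incβ1 (incI-yes e iβ))
    atβ (no nβ) with orient α e iα | filter-witness (incident? β) R (subst (0 <_) (sym incβR) (s≤s z≤n))
      where
      incβR : inc β R ≡ 1
      incβR = incSplit0 β e R incβ1 (incI-no e nβ)
    ... | a , ore | e' , e'∈R , iβ' with ∈-∃++ e'∈R | orient β e' iβ'
    ...   | A' , B' , eqR | b , ore' =
      matchingSwitchable-separate _ R' perm ore ore' (a≢α , orIncA ore nβ) (orIncA ore' notIα' , b≢β) incαR' incβR'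
      where
      R' = A' ++ B'
      perm2 : R ↭ e' ∷ R'
      perm2 = subst (_↭ e' ∷ R') (sym eqR) (shift e' A' B')
      perm : A ++ e ∷ B ↭ e ∷ e' ∷ R'
      perm = ↭-trans perm1 (prep e perm2)
      a≢α : a ≢ α
      a≢α p = orNL ore nle (sym p)
      b≢β : b ≢ β
      b≢β p = orNL ore' (All-lookup nl (∈-resp-↭ (↭-sym perm) (there (here refl)))) (sym p)
      incα' : inc α (e' ∷ R') ≡ 0
      incα' = trans (sym (inc-↭ α perm2)) incαR
      notIα' : ¬ Incident α e'
      notIα' i = 1+n≢0 (trans (cong (_+ inc α R') (sym (incI-yes e' i))) (trans (sym (inc-∷ α e' R')) incα'))
      incαR' : inc α R' ≡ 0
      incαR' = incSplit0 α e' R' incα' (incI-no e' notIα')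
      incβR' : inc β R' ≡ 0
      incβR' = incSplit β e' R' (trans (sym (inc-↭ β perm2)) (incSplit0 β e R incβ1 (incI-no e nβ))) (incI-yes e' iβ')

-- Switching a whole packing (a list of cycles and a matching) at once: the
-- links of all its parts are concatenated and one flag list serves them all.
module SwitchAll {n : ℕ} (α β : Fin n) (α≢β : α ≢ β) where
  open CycleSwitch α β α≢β
  open MatchingSwitch α β α≢β

  data AllSwitchable : List (List (Fin n)) → Set where
    [] : AllSwitchable []
    _∷_ : ∀ {c cs} → Switchable c → AllSwitchable cs → AllSwitchable (c ∷ cs)

  allLinks : ∀ {cs} → AllSwitchable cs → List (Link {n})
  allLinks [] = []
  allLinks (A ∷ As) = Switchable.us A ++ allLinks As

  applyAll : ∀ {cs} → AllSwitchable cs → List Bool → List (List (Fin n))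
  applyAll [] fs = []
  applyAll (A ∷ As) fs = Switchable.apply A fs ∷ applyAll As (dropPad (length (Switchable.us A)) fs)

  allSwitchable : ∀ cs → All IsCyc cs → AllSwitchable cs
  allSwitchable [] [] = []
  allSwitchable (c ∷ cs) ((_ , l , u) ∷ ps) = cycleSwitchable c u l ∷ allSwitchable cs ps

  lensAll : ∀ {cs} (As : AllSwitchable cs) fs → map length (applyAll As fs) ≡ map length cs
  lensAll [] fs = refl
  lensAll (A ∷ As) fs = cong₂ _∷_ (Switchable.ap-len A fs) (lensAll As _)

  cycAll : ∀ {cs} (As : AllSwitchable cs) → All IsCyc cs → ∀ fs → All IsCyc (applyAll As fs)
  cycAll [] [] fs = []
  cycAll (A ∷ As) ((_ , l , _) ∷ ps) fs = (refl , subst (2 ≤_) (sym (Switchable.ap-len A fs)) l , Switchable.ap-uniq A fs) ∷ cycAll As ps _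

  edgesAll : ∀ {cs} (As : AllSwitchable cs) fs → concatMap cycleEdges (applyAll As fs) ++ endEdges (select fs (allLinks As))
                                        ≋ concatMap cycleEdges cs ++ endEdges (map opp (select fs (allLinks As)))
  edgesAll [] fs = ≋-refl
  edgesAll {c ∷ cs} (A ∷ As) fs =
    ≋-trans (≋-≡ e1) (≋-trans (mult-interchange (cycleEdges (Switchable.apply A fs)) (concatMap cycleEdges (applyAll As fs2)) (endEdges s1) (endEdges s2))
      (≋-trans (++-cong (Switchable.ap-edges A fs) (edgesAll As fs2))
        (≋-trans (mult-interchange (cycleEdges c) (endEdges (map opp s1)) (concatMap cycleEdges cs) (endEdges (map opp s2))) (≋-≡ (sym e2)))))
    where
    fs2 = dropPad (length (Switchable.us A)) fs
    s1 = select fs (Switchable.us A)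
    s2 = select fs2 (allLinks As)
    e1 : concatMap cycleEdges (applyAll (A ∷ As) fs) ++ endEdges (select fs (allLinks (A ∷ As)))
         ≡ (cycleEdges (Switchable.apply A fs) ++ concatMap cycleEdges (applyAll As fs2)) ++ (endEdges s1 ++ endEdges s2)
    e1 = cong (concatMap cycleEdges (applyAll (A ∷ As) fs) ++_) (trans (cong endEdges (select-++ (Switchable.us A) fs (allLinks As))) (map-++ endEdge s1 s2))
    e2 : concatMap cycleEdges (c ∷ cs) ++ endEdges (map opp (select fs (allLinks (A ∷ As))))
         ≡ (cycleEdges c ++ concatMap cycleEdges cs) ++ (endEdges (map opp s1) ++ endEdges (map opp s2))
    e2 = cong (concatMap cycleEdges (c ∷ cs) ++_) (trans (cong (λ z → endEdges (map opp z)) (select-++ (Switchable.us A) fs (allLinks As)))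
           (trans (cong endEdges (map-++ opp s1 s2)) (map-++ endEdge (map opp s1) (map opp s2))))

  cntAll : ∀ {cs} (As : AllSwitchable cs) y → Off y → ∀ c → mult (pole c) y (concatMap cycleEdges cs) ≡ countEnd (y , c) (linkEnds (allLinks As))
  cntAll [] y g c = refl
  cntAll {c0 ∷ cs} (A ∷ As) y g c = trans (mult-++ (pole c) y (cycleEdges c0) (concatMap cycleEdges cs))
     (trans (cong₂ _+_ (Switchable.cntOK A y g c) (cntAll As y g c))
       (sym (trans (cong (countEnd (y , c)) (linkEnds-++ (Switchable.us A) (allLinks As))) (countEnd-++ (y , c) (linkEnds (Switchable.us A)) (linkEnds (allLinks As))))))

  endsAll : ∀ {cs} (As : AllSwitchable cs) → All (λ e → Off (proj₁ e)) (linkEnds (allLinks As))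
  endsAll [] = []
  endsAll (A ∷ As) = subst (All (λ e → Off (proj₁ e))) (sym (linkEnds-++ (Switchable.us A) (allLinks As))) (AllP.++⁺ (Switchable.endsOK A) (endsAll As))

  -- An (α,β)-switch of the packing with origin x: it exchanges the pole of
  -- the edge at x (colour not c → c) and of one edge at the terminus y.
  record SwitchOutcome (cs : List (List (Fin n))) (mt : List (Edge n)) (x : Fin n) (c : Bool) : Set where
    field
      cs' : List (List (Fin n))
      mt' : List (Edge n)
      y : Fin n
      c' : Bool
      lens : map length cs' ≡ map length cs
      cyc : All IsCyc cs'
      emp : mt ≡ [] → mt' ≡ []
      perf : IsPerfectMatching n mt → IsPerfectMatching n mt'
      goodY : Off y
      endc : ι (y , not c') (x , not c) + mult (pole (not c')) y (concatMap cycleEdges cs ++ mt)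
             < ι (y , c') (x , not c) + mult (pole c') y (concatMap cycleEdges cs ++ mt)
      bal : (concatMap cycleEdges cs' ++ mt') ++ endEdges ((x , c) ∷ (y , c') ∷ [])
            ≋ (concatMap cycleEdges cs ++ mt) ++ endEdges ((x , not c) ∷ (y , not c') ∷ [])

  -- Apply the chain lemma to the ends of all links of the packing, starting at
  -- the end (x , c), which is in excess over (x , not c).
  switchCycles : ∀ cs mt → All IsCyc cs → MatchingSwitchable mt → ∀ x → Off x → ∀ c →
       mult (pole (not c)) x (concatMap cycleEdges cs ++ mt) < mult (pole c) x (concatMap cycleEdges cs ++ mt) →
       SwitchOutcome cs mt x c
  switchCycles cs mt ps M x gx c lt = record
    { cs' = applyAll As fs
    ; mt' = MatchingSwitchable.applyM M fs2
    ; y = proj₁ t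
    ; c' = proj₂ t
    ; lens = lensAll As fs
    ; cyc = cycAll As ps fs
    ; emp = λ e → MatchingSwitchable.apM-empty M e fs2
    ; perf = λ p → MatchingSwitchable.apM-perf M p fs2
    ; goodY = gy
    ; endc = subst₂ _<_ (cong (ι (proj₁ t , not (proj₂ t)) (x , not c) +_) (sym (cntP (proj₁ t) gy (not (proj₂ t)))))
                        (cong (ι (proj₁ t , proj₂ t) (x , not c) +_) (sym (cntP (proj₁ t) gy (proj₂ t)))) cond
    ; bal = balance
    }
    where
    P = concatMap cycleEdges cs ++ mt
    As = allSwitchable cs ps
    uC = allLinks As
    uM = MatchingSwitchable.usM M
    us = uC ++ uM
    k = length uC
    cntP : ∀ y → Off y → ∀ c → mult (pole c) y P ≡ countEnd (y , c) (linkEnds us)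
    cntP y g c = trans (mult-++ (pole c) y (concatMap cycleEdges cs) mt)
       (trans (cong₂ _+_ (cntAll As y g c) (MatchingSwitchable.cntM M y g c))
         (sym (trans (cong (countEnd (y , c)) (linkEnds-++ uC uM)) (countEnd-++ (y , c) (linkEnds uC) (linkEnds uM)))))
    start : countEnd (opp (x , c)) (linkEnds us) < countEnd (x , c) (linkEnds us)
    start = subst₂ _<_ (cntP x gx (not c)) (cntP x gx c) lt
    res = chainSwitch (length us) us ≤-refl (x , c) start
    fs = proj₁ res
    t = proj₁ (proj₂ res)
    cond = proj₁ (proj₂ (proj₂ res))
    bal0 = proj₂ (proj₂ (proj₂ res))
    fs2 = dropPad k fs
    endsGood : All (λ e → Off (proj₁ e)) (linkEnds us)
    endsGood = subst (All (λ e → Off (proj₁ e))) (sym (linkEnds-++ uC uM)) (AllP.++⁺ (endsAll As) (MatchingSwitchable.endsM M))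
    gy : Off (proj₁ t)
    gy with countEnd-pos⇒∈ t (opp (x , c) ∷ linkEnds us) (≤-<-trans z≤n cond)
    ... | here eq = subst Off (sym (cong proj₁ eq)) gx
    ... | there m = All-lookup endsGood m
    S = select fs us
    S1 = select fs uC
    S2 = select fs2 uM
    P' = concatMap cycleEdges (applyAll As fs) ++ MatchingSwitchable.applyM M fs2
    e1 : P' ++ endEdges S ≋ P ++ endEdges (map opp S)
    e1 = ≋-trans (≋-≡ (cong (P' ++_) (trans (cong endEdges (select-++ uC fs uM)) (map-++ endEdge S1 S2))))
          (≋-trans (mult-interchange (concatMap cycleEdges (applyAll As fs)) (MatchingSwitchable.applyM M fs2) (endEdges S1) (endEdges S2))
          (≋-trans (++-cong (edgesAll As fs) (MatchingSwitchable.apM-edges M fs2))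
          (≋-trans (mult-interchange (concatMap cycleEdges cs) (endEdges (map opp S1)) mt (endEdges (map opp S2)))
            (≋-≡ (sym (cong (P ++_) (trans (cong (λ z → endEdges (map opp z)) (select-++ uC fs uM))
                 (trans (cong endEdges (map-++ opp S1 S2)) (map-++ endEdge (map opp S1) (map opp S2))))))))))
    s = (x , c)
    e2 : endEdges S ++ endEdges (opp s ∷ opp t ∷ []) ≋ endEdges (map opp S) ++ endEdges (s ∷ t ∷ [])
    e2 = ≋-trans (≋-≡ (sym (map-++ endEdge S (opp s ∷ opp t ∷ []))))
          (≋-trans (↭⇒≋ (map⁺ endEdge (≈E⇒↭ _ _ (runE bal0)))) (≋-≡ (map-++ endEdge (map opp S) (s ∷ t ∷ []))))
    balance : P' ++ endEdges (s ∷ t ∷ []) ≋ P ++ endEdges (opp s ∷ opp t ∷ [])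
    balance = ≋-transfer {P = P} {P'} {endEdges S} {endEdges (map opp S)} {endEdges (opp s ∷ opp t ∷ [])} {endEdges (s ∷ t ∷ [])} e1 e2

module _ {n : ℕ} where
  mult-lastTwo : ∀ (Gs : List (List (Fin n))) C T mt u v →
    mult u v (concatMap cycleEdges (Gs ++ C ∷ T ∷ []) ++ mt) ≡ mult u v ((concatMap cycleEdges Gs ++ mt) ++ (cycleEdges C ++ cycleEdges T))
  mult-lastTwo Gs C T mt u v = begin
      mult u v (concatMap cycleEdges (Gs ++ C ∷ T ∷ []) ++ mt)
    ≡⟨ cong (λ z → mult u v (z ++ mt)) (concatMap-++ cycleEdges Gs (C ∷ T ∷ [])) ⟩
      mult u v ((G ++ (cycleEdges C ++ (cycleEdges T ++ []))) ++ mt)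
    ≡⟨ cong (λ z → mult u v ((G ++ (cycleEdges C ++ z)) ++ mt)) (++-identityʳ (cycleEdges T)) ⟩
      mult u v ((G ++ (cycleEdges C ++ cycleEdges T)) ++ mt)
    ≡⟨ run (mult-interchange G (cycleEdges C ++ cycleEdges T) [] mt) u v ⟩
      mult u v ((G ++ []) ++ ((cycleEdges C ++ cycleEdges T) ++ mt))
    ≡⟨ cong (λ z → mult u v (z ++ ((cycleEdges C ++ cycleEdges T) ++ mt))) (++-identityʳ G) ⟩
      mult u v (G ++ ((cycleEdges C ++ cycleEdges T) ++ mt))
    ≡⟨ run (++-cong (≋-refl {xs = G}) (++-comm≋ (cycleEdges C ++ cycleEdges T) mt)) u v ⟩
      mult u v (G ++ (mt ++ (cycleEdges C ++ cycleEdges T)))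
    ≡⟨ cong (mult u v) (sym (++-assoc G mt (cycleEdges C ++ cycleEdges T))) ⟩
      mult u v ((G ++ mt) ++ (cycleEdges C ++ cycleEdges T))
    ∎
    where
    open ≡-Reasoning
    G = concatMap cycleEdges Gs

mod2-cases : ∀ k → k % 2 ≡ 0 ⊎ k % 2 ≡ 1
mod2-cases k with k % 2 | m%n<n k 2
... | 0 | _ = inj₁ refl
... | 1 | _ = inj₂ refl
... | suc (suc _) | s≤s (s≤s ())

complement-< : ∀ {l} a b a' b' → a + b ≡ l → a' + b' ≡ l → b < b' → a' < a
complement-< a b a' b' h1 h2 lt = +-cancelʳ-< b a' a (subst (a' + b <_) (trans h2 (sym h1)) (+-monoʳ-< a' lt))

complement-<-offset : ∀ {l} a b a' b' i₁ i₂ → a + b ≡ l → a' + b' ≡ l → i₁ + a' < i₂ + a → i₁ + b < i₂ + b'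
complement-<-offset {l} a b a' b' i₁ i₂ h1 h2 lt = +-cancelʳ-< l (i₁ + b) (i₂ + b')
   (subst₂ _<_ (trans (e1 i₁ a' b a b') (cong (λ z → i₁ + b + z) h2)) (trans (e2 i₂ a b b') (cong (λ z → i₂ + b' + z) h1)) (+-monoˡ-< (b + b') lt))
  where
  e1 : ∀ i a' b a b' → i + a' + (b + b') ≡ i + b + (a' + b')
  e1 = solve-∀
  e2 : ∀ i a b b' → i + a + (b + b') ≡ i + b' + (a + b)
  e2 = solve-∀

record Packing (M : List ℕ) (l n : ℕ) : Set where
  field
    Gs : List (List (Fin n))
    mt : List (Edge n)
    lensG : map length Gs ≡ M
    cycG : All IsCyc Gs
    evenC : (l * (n ∸ 1)) % 2 ≡ 0 → mt ≡ []
    oddC : (l * (n ∸ 1)) % 2 ≡ 1 → IsPerfectMatching n mt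

module _ {M : List ℕ} {l n : ℕ} where
  packingEdges : Packing M l n → List (Edge n)
  packingEdges K = concatMap cycleEdges (Packing.Gs K) ++ Packing.mt K

  Covers : Packing M l n → List (Edge n) → Set
  Covers K L = ∀ (u v : Fin n) → u ≢ v → mult u v (packingEdges K ++ L) ≡ l

  covers-≋ : ∀ K {L L'} → Covers K L → L' ≋ L → Covers K L'
  covers-≋ K {L} {L'} cv e u v uv = trans (trans (mult-++ u v (packingEdges K) L') (cong (mult u v (packingEdges K) +_) (run e u v))) (trans (sym (mult-++ u v (packingEdges K) L)) (cv u v uv))

  covers-exchange : ∀ (K K' : Packing M l n) {L L' N N'} → Covers K L →
    packingEdges K' ++ N ≋ packingEdges K ++ N' → L' ++ N' ≋ L ++ N → Covers K' L'
  covers-exchange K K' {L} {L'} {N} {N'} cv eK eL u v uv = +-cancelʳ-≡ (mN + mN') (mult u v (packingEdges K' ++ L')) l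
      (trans (cong (_+ (mN + mN')) (mult-++ u v (packingEdges K') L'))
      (trans (arr (mult u v (packingEdges K')) (mult u v L') mN mN')
      (trans (cong₂ _+_ (trans (sym (mult-++ u v (packingEdges K') N)) (trans (run eK u v) (mult-++ u v (packingEdges K) N')))
                        (trans (sym (mult-++ u v L' N')) (trans (run eL u v) (mult-++ u v L N))))
      (trans (arr2 (mult u v (packingEdges K)) mN' (mult u v L) mN) (cong (_+ (mN + mN')) (trans (sym (mult-++ u v (packingEdges K) L)) (cv u v uv)))))))
    where
    mN = mult u v N
    mN' = mult u v N'
    arr : ∀ p l' s t → (p + l') + (s + t) ≡ (p + s) + (l' + t)
    arr = solve-∀
    arr2 : ∀ p t q s → (p + t) + (q + s) ≡ (p + q) + (s + t)
    arr2 = solve-∀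

  rebuild : ∀ (K : Packing M l n) (C T : List (Fin n)) → IsCyc C → IsCyc T → Covers K (cycleEdges C ++ cycleEdges T)
            → Decomposition (M ++ length C ∷ length T ∷ []) l n
  rebuild K C T pC pT cv = record
    { cycles = Gs ++ C ∷ T ∷ []
    ; matching = mt
    ; lengths = trans (map-++ length Gs (C ∷ T ∷ [])) (cong (_++ length C ∷ length T ∷ []) lensG)
    ; areCycles = AllP.++⁺ cycG (pC ∷ pT ∷ [])
    ; evenCase = evenC
    ; oddCase = oddC
    ; covers = λ u v uv → trans (mult-lastTwo Gs C T mt u v) (cv u v uv)
    }
    where open Packing K

  record SwitchResult (K : Packing M l n) (L : List (Edge n)) (α β : Fin n) (α≢β : α ≢ β) (x : Fin n) (c : Bool) : Set where
    open Poles α β α≢β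
    field
      K' : Packing M l n
      y : Fin n
      c' : Bool
      goodY : Off y
      endcL : ι (y , not c') (x , not c) + mult (pole c') y L < ι (y , c') (x , not c) + mult (pole (not c')) y L
      trans' : ∀ L' → L' ++ endEdges ((x , not c) ∷ (y , not c') ∷ []) ≋ L ++ endEdges ((x , c) ∷ (y , c') ∷ []) → Covers K' L'

  -- Since every pair u, v is covered exactly λ times, an excess of pole c over
  -- pole (not c) at x in L is a deficit in K; switchCycles then applies, and
  -- the inequality for y is transferred back to L.
  switchLeave : ∀ (K : Packing M l n) L → Covers K L → ∀ α β (α≢β : α ≢ β) x → Poles.Off α β α≢β x → ∀ c →
             mult (Poles.pole α β α≢β c) x L < mult (Poles.pole α β α≢β (not c)) x L → SwitchResult K L α β α≢β x c
  switchLeave K L cv α β α≢β x gx c startL = record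
    { K' = K'
    ; y = R.y
    ; c' = R.c'
    ; goodY = R.goodY
    ; endcL = complement-<-offset (mult (pole R.c') R.y (packingEdges K)) (mult (pole R.c') R.y L) (mult (pole (not R.c')) R.y (packingEdges K)) (mult (pole (not R.c')) R.y L)
                (ι (R.y , not R.c') (x , not c)) (ι (R.y , R.c') (x , not c))
                (cv' (pole R.c') R.y (λ q → off≢pole R.goodY R.c' (sym q))) (cv' (pole (not R.c')) R.y (λ q → off≢pole R.goodY (not R.c') (sym q))) R.endc
    ; trans' = tr
    }
    where
    open Poles α β α≢β
    open SwitchAll α β α≢β
    open MatchingSwitch α β α≢β
    open Packing K
    cv' : ∀ u v → u ≢ v → mult u v (packingEdges K) + mult u v L ≡ l
    cv' u v uv = trans (sym (mult-++ u v (packingEdges K) L)) (cv u v uv)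
    manl : MatchingSwitchable mt
    manl with mod2-cases (l * (n ∸ 1))
    ... | inj₁ p = subst MatchingSwitchable (sym (evenC p)) matchingSwitchable-empty
    ... | inj₂ p = matchingSwitchable-perfect mt (oddC p)
    start : mult (pole (not c)) x (packingEdges K) < mult (pole c) x (packingEdges K)
    start = complement-< (mult (pole c) x (packingEdges K)) (mult (pole c) x L) (mult (pole (not c)) x (packingEdges K)) (mult (pole (not c)) x L)
              (cv' (pole c) x (λ q → off≢pole gx c (sym q))) (cv' (pole (not c)) x (λ q → off≢pole gx (not c) (sym q))) startL
    R = switchCycles Gs mt cycG manl x gx c start
    module R = SwitchOutcome R
    K' : Packing M l n
    K' = record { Gs = R.cs' ; mt = R.mt' ; lensG = trans R.lens lensG ; cycG = R.cyc
                ; evenC = λ p → R.emp (evenC p) ; oddC = λ p → R.perf (oddC p) }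
    tr : ∀ L' → L' ++ endEdges ((x , not c) ∷ (R.y , not R.c') ∷ []) ≋ L ++ endEdges ((x , c) ∷ (R.y , R.c') ∷ []) → Covers K' L'
    tr L' e = covers-exchange K K' cv R.bal e

-- Case w ∉ C = (u a b c Q), leave L = C ∪ {uw, uw}.  Switch (w, b) with
-- origin a: either the terminus is c, giving the cycles (u w c Q) and
-- (u w a), or it is u, giving (u b c Q) and (u w a).
module OffCycle {M : List ℕ} {l n : ℕ} (K : Packing M l n) (u w a b c : Fin n) (Q : List (Fin n))
   (uq : Unique (u ∷ a ∷ b ∷ c ∷ Q)) (nw : w ∉ u ∷ a ∷ b ∷ c ∷ Q)
   (cv : Covers K (cycleEdges (u ∷ a ∷ b ∷ c ∷ Q) ++ cycleEdges (u ∷ w ∷ []))) where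

  L : List (Edge n)
  L = cycleEdges (u ∷ a ∷ b ∷ c ∷ Q) ++ cycleEdges (u ∷ w ∷ [])
  rest : List (Edge n)
  rest = closeEdges u (c ∷ Q)

  u≢a : u ≢ a
  u≢b : u ≢ b
  u≢c : u ≢ c
  uQ : u ∉ Q
  a≢b : a ≢ b
  a≢c : a ≢ c
  b≢c : b ≢ c
  bQ : b ∉ Q
  cQ : c ∉ Q
  uqQ : Unique Q
  u≢a = All.head (AllPairs.head uq)
  u≢b = All.head (All.tail (AllPairs.head uq))
  u≢c = All.head (All.tail (All.tail (AllPairs.head uq)))
  uQ = All¬⇒¬Any (All.tail (All.tail (All.tail (AllPairs.head uq))))
  a≢b = All.head (AllPairs.head (AllPairs.tail uq))
  a≢c = All.head (All.tail (AllPairs.head (AllPairs.tail uq)))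
  b≢c = All.head (AllPairs.head (AllPairs.tail (AllPairs.tail uq)))
  bQ = All¬⇒¬Any (All.tail (AllPairs.head (AllPairs.tail (AllPairs.tail uq))))
  cQ = All¬⇒¬Any (AllPairs.head (AllPairs.tail (AllPairs.tail (AllPairs.tail uq))))
  uqQ = AllPairs.tail (AllPairs.tail (AllPairs.tail (AllPairs.tail uq)))

  w≢u : w ≢ u
  w≢u p = nw (here p)
  w≢a : w ≢ a
  w≢a p = nw (there (here p))
  w≢b : w ≢ b
  w≢b p = nw (there (there (here p)))
  w≢c : w ≢ c
  w≢c p = nw (there (there (there (here p))))
  wQ : w ∉ Q
  wQ m = nw (there (there (there (there m))))

  rest-avoid : ∀ x y → x ≢ c → x ∉ Q → x ≢ u → mult x y rest ≡ 0
  rest-avoid x y xc xQ xu = trans (cong (mult x y) (closeEdges-path u (c ∷ Q))) (pathEdges-avoid x y (c ∷ Q ++ u ∷ []) (∉∷ xc (∉++ Q xQ (∉∷ xu λ ()))))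

  mult-L : ∀ x y → mult x y L ≡ (δ x y (u , a) + (δ x y (a , b) + (δ x y (b , c) + mult x y rest))) + (δ x y (u , w) + (δ x y (w , u) + 0))
  mult-L x y = trans (mult≡mult′ x y L) (trans (mult′-++ x y ((u , a) ∷ (a , b) ∷ (b , c) ∷ rest) ((u , w) ∷ (w , u) ∷ []))
               (cong (λ z → (δ x y (u , a) + (δ x y (a , b) + (δ x y (b , c) + z))) + (δ x y (u , w) + (δ x y (w , u) + 0))) (sym (mult≡mult′ x y rest))))

  -- Multiplicities in L at w and b, which restrict the possible termini.
  mult-w : ∀ y → y ≢ u → y ≢ w → mult w y L ≡ 0
  mult-w y yu yw rewrite mult-L w y | δ0x {x = w} {y = y} (≢-sym w≢u) (≢-sym w≢a) | δ0x {x = w} {y = y} (≢-sym w≢a) (≢-sym w≢b) | δ0x {x = w} {y = y} (≢-sym w≢b) (≢-sym w≢c)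
                   | rest-avoid w y w≢c wQ w≢u | δ0y {x = w} {y = y} (≢-sym yu) (≢-sym yw) | δ0y {x = w} {y = y} (≢-sym yw) (≢-sym yu) = refl

  mult-b : ∀ y → y ≢ a → y ≢ c → y ≢ b → mult b y L ≡ 0
  mult-b y ya yc yb rewrite mult-L b y | δ0x {x = b} {y = y} u≢b a≢b | δ0y {x = b} {y = y} (≢-sym ya) (≢-sym yb) | δ0y {x = b} {y = y} (≢-sym yb) (≢-sym yc)
                   | rest-avoid b y b≢c bQ (≢-sym u≢b) | δ0x {x = b} {y = y} u≢b w≢b | δ0x {x = b} {y = y} w≢b u≢b = refl

  mult-ba : mult b a L ≡ 1
  mult-ba rewrite mult-L b a | δ0x {x = b} {y = a} u≢b a≢b | δ-yes {u = b} {v = a} {e = (a , b)} (inj₂ (refl , refl)) | δ0y {x = b} {y = a} (≢-sym a≢b) (≢-sym a≢c)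
             | rest-avoid b a b≢c bQ (≢-sym u≢b) | δ0x {x = b} {y = a} u≢b w≢b | δ0x {x = b} {y = a} w≢b u≢b = refl

  open Poles w b w≢b using (Off; pole; endEdges)

  a-off : Off a
  a-off = (≢-sym w≢a , a≢b)

  excess-at-origin : mult w a L < mult b a L
  excess-at-origin = subst₂ _<_ (sym (mult-w a (≢-sym u≢a) (≢-sym w≢a))) (sym mult-ba) (s≤s z≤n)

  switch : SwitchResult K L w b w≢b a true
  switch = switchLeave K L cv w b w≢b a a-off true excess-at-origin
  K' : Packing M l n
  K' = SwitchResult.K' switch

  C1 : List (Fin n)
  C1 = u ∷ w ∷ c ∷ Q
  T : List (Fin n)
  T = u ∷ w ∷ a ∷ []

  T-cycle : IsCyc T
  T-cycle = refl , s≤s (s≤s z≤n) , uniq-cons (∉∷ (≢-sym w≢u) (∉∷ u≢a λ ())) (uniq-cons (∉∷ w≢a λ ()) (uniq-cons (λ ()) []))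

  C1-cycle : IsCyc C1
  C1-cycle = refl , s≤s (s≤s z≤n) , uniq-cons (∉∷ (≢-sym w≢u) (∉∷ u≢c uQ)) (uniq-cons (∉∷ w≢c wQ) (uniq-cons cQ uqQ))

  C2 : List (Fin n)
  C2 = u ∷ b ∷ c ∷ Q
  C2-cycle : IsCyc C2
  C2-cycle = refl , s≤s (s≤s z≤n) , uniq-cons (∉∷ u≢b (∉∷ u≢c uQ)) (uniq-cons (∉∷ b≢c bQ) (uniq-cons cQ uqQ))

  finish₁ : (∀ L' → L' ++ endEdges ((a , false) ∷ (c , false) ∷ []) ≋ L ++ endEdges ((a , true) ∷ (c , true) ∷ []) → Covers K' L') →
         Decomposition (M ++ length C1 ∷ 3 ∷ []) l n
  finish₁ tr = rebuild K' C1 T C1-cycle T-cycle (tr (cycleEdges C1 ++ cycleEdges T) (≋-by-mult′ eqn))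
    where
    eqn : ∀ x y → mult′ x y ((cycleEdges C1 ++ cycleEdges T) ++ endEdges ((a , false) ∷ (c , false) ∷ []))
                ≡ mult′ x y ((cycleEdges (u ∷ a ∷ b ∷ c ∷ Q) ++ cycleEdges (u ∷ w ∷ [])) ++ endEdges ((a , true) ∷ (c , true) ∷ []))
    eqn x y = trans (mult′-++₃ x y (cycleEdges C1) (cycleEdges T) (endEdges ((a , false) ∷ (c , false) ∷ [])))
               (trans (lem (δ x y (u , w)) (δ x y (w , c)) (mult′ x y rest) (δ x y (w , a)) (δ x y (a , u)) (δ x y (u , a)) (δ x y (b , a)) (δ x y (a , b)) (δ x y (b , c)) (δ x y (w , u))
                        (δ-flip x y a u) (δ-flip x y b a) (δ-flip x y w u))
               (sym (mult′-++₃ x y (cycleEdges (u ∷ a ∷ b ∷ c ∷ Q)) (cycleEdges (u ∷ w ∷ [])) (endEdges ((a , true) ∷ (c , true) ∷ [])))))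
      where
      lem0 : ∀ uw wc k wa ua ab bc → (uw + (wc + k) + (uw + (wa + (ua + 0)))) + (ab + (bc + 0))
                                  ≡ (ua + (ab + (bc + k)) + (uw + (uw + 0))) + (wa + (wc + 0))
      lem0 = solve-∀
      lem : ∀ uw wc k wa au ua ba ab bc wu → au ≡ ua → ba ≡ ab → wu ≡ uw →
            (uw + (wc + k) + (uw + (wa + (au + 0)))) + (ba + (bc + 0)) ≡ (ua + (ab + (bc + k)) + (uw + (wu + 0))) + (wa + (wc + 0))
      lem uw wc k wa au ua ba ab bc wu refl refl refl = lem0 uw wc k wa ua ab bc

  finish₂ : (∀ L' → L' ++ endEdges ((a , false) ∷ (u , true) ∷ []) ≋ L ++ endEdges ((a , true) ∷ (u , false) ∷ []) → Covers K' L') →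
         Decomposition (M ++ length C1 ∷ 3 ∷ []) l n
  finish₂ tr = rebuild K' C2 T C2-cycle T-cycle (tr (cycleEdges C2 ++ cycleEdges T) (≋-by-mult′ eqn))
    where
    eqn : ∀ x y → mult′ x y ((cycleEdges C2 ++ cycleEdges T) ++ endEdges ((a , false) ∷ (u , true) ∷ []))
                ≡ mult′ x y ((cycleEdges (u ∷ a ∷ b ∷ c ∷ Q) ++ cycleEdges (u ∷ w ∷ [])) ++ endEdges ((a , true) ∷ (u , false) ∷ []))
    eqn x y = trans (mult′-++₃ x y (cycleEdges C2) (cycleEdges T) (endEdges ((a , false) ∷ (u , true) ∷ [])))
               (trans (lem (δ x y (u , b)) (δ x y (b , c)) (mult′ x y rest) (δ x y (u , w)) (δ x y (w , a)) (δ x y (a , u)) (δ x y (u , a)) (δ x y (b , a)) (δ x y (a , b)) (δ x y (w , u)) (δ x y (b , u))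
                        (δ-flip x y a u) (δ-flip x y b a) (δ-flip x y b u))
               (sym (mult′-++₃ x y (cycleEdges (u ∷ a ∷ b ∷ c ∷ Q)) (cycleEdges (u ∷ w ∷ [])) (endEdges ((a , true) ∷ (u , false) ∷ [])))))
      where
      lem0 : ∀ ub bc k uw wa ua ab wu → (ub + (bc + k) + (uw + (wa + (ua + 0)))) + (ab + (wu + 0))
                                  ≡ (ua + (ab + (bc + k)) + (uw + (wu + 0))) + (wa + (ub + 0))
      lem0 = solve-∀
      lem : ∀ ub bc k uw wa au ua ba ab wu bu → au ≡ ua → ba ≡ ab → bu ≡ ub →
            (ub + (bc + k) + (uw + (wa + (au + 0)))) + (ba + (wu + 0)) ≡ (ua + (ab + (bc + k)) + (uw + (wu + 0))) + (wa + (bu + 0))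
      lem ub bc k uw wa au ua ba ab wu bu refl refl refl = lem0 ub bc k uw wa ua ab wu

-- The remaining termini contradict the end condition of switchLeave.
offCycleCase : ∀ {M l n} (K : Packing M l n) (u w a b c : Fin n) (Q : List (Fin n)) →
        Unique (u ∷ a ∷ b ∷ c ∷ Q) → w ∉ u ∷ a ∷ b ∷ c ∷ Q →
        Covers K (cycleEdges (u ∷ a ∷ b ∷ c ∷ Q) ++ cycleEdges (u ∷ w ∷ [])) →
        Decomposition (M ++ length (u ∷ w ∷ c ∷ Q) ∷ 3 ∷ []) l n
offCycleCase {M} {l} {n} K u w a b c Q uq nw cv = atTerminus (SwitchResult.y switch) (SwitchResult.c' switch) (SwitchResult.goodY switch) (SwitchResult.endcL switch) (SwitchResult.trans' switch)
  where
  open OffCycle K u w a b c Q uq nw cv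
  open Poles w b w≢b using (Off; pole; endEdges)
  EndCondition : Fin n → Bool → Set
  EndCondition y c' = ι (y , not c') (a , false) + mult (pole c') y L < ι (y , c') (a , false) + mult (pole (not c')) y L
  Exchange : Fin n → Bool → Set
  Exchange y c' = ∀ L' → L' ++ endEdges ((a , false) ∷ (y , not c') ∷ []) ≋ L ++ endEdges ((a , true) ∷ (y , c') ∷ []) → Covers K' L'
  Goal = Decomposition (M ++ length (u ∷ w ∷ c ∷ Q) ∷ 3 ∷ []) l n

  terminus-w : ∀ y → Dec (y ≡ c) → Dec (y ≡ a) → Off y → EndCondition y true → Exchange y true → Goal
  terminus-w y (yes refl) _ gy ec tr = finish₁ tr
  terminus-w y (no yc) (yes refl) gy ec tr = ⊥-elim (<-irrefl refl (subst₂ _<_ (cong₂ _+_ (ι-yes refl) (mult-w a (≢-sym u≢a) (≢-sym w≢a))) (cong₂ _+_ (ιTF a a) mult-ba) ec))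
  terminus-w y (no yc) (no ya) gy ec tr = ⊥-elim (n≮0 (subst (ι (y , false) (a , false) + mult w y L <_) (cong₂ _+_ (ιTF y a) (mult-b y ya yc (proj₂ gy))) ec))

  terminus-b : ∀ y → Dec (y ≡ u) → Dec (y ≡ a) → Off y → EndCondition y false → Exchange y false → Goal
  terminus-b y (yes refl) _ gy ec tr = finish₂ tr
  terminus-b y (no yu) (yes refl) gy ec tr = ⊥-elim (<-irrefl refl (subst₂ _<_ (cong₂ _+_ (ιTF a a) mult-ba) (cong₂ _+_ (ι-yes refl) (mult-w a (≢-sym u≢a) (≢-sym w≢a))) ec))
  terminus-b y (no yu) (no ya) gy ec tr = ⊥-elim (n≮0 (subst (ι (y , true) (a , false) + mult b y L <_) (cong₂ _+_ (ιne false ya) (mult-w y yu (proj₁ gy))) ec))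

  atTerminus : ∀ y c' → Off y → EndCondition y c' → Exchange y c' → Goal
  atTerminus y true = terminus-w y (y ≟ c) (y ≟ a)
  atTerminus y false = terminus-b y (y ≟ u) (y ≟ a)

-- Case C = (u P w b): the leave splits directly into (u P w) and (u w b).
module AdjacentCase {M : List ℕ} {l n : ℕ} (K : Packing M l n) (u w b : Fin n) (P : List (Fin n))
   (uq : Unique (u ∷ P ++ w ∷ b ∷ []))
   (cv : Covers K (cycleEdges (u ∷ P ++ w ∷ b ∷ []) ++ cycleEdges (u ∷ w ∷ []))) where

  u∉ : u ∉ P ++ w ∷ b ∷ []
  u∉ = Unique[x∷xs]⇒x∉xs uq
  wnot : w ∉ P ++ b ∷ []
  wnot = uniq-mid P (b ∷ []) (AllPairs.tail uq)
  u≢w : u ≢ w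
  u≢w p = u∉ (∈-++⁺ʳ P (here p))
  u≢b : u ≢ b
  u≢b p = u∉ (∈-++⁺ʳ P (there (here p)))
  w≢b : w ≢ b
  w≢b p = wnot (∈-++⁺ʳ P (here p))

  C1 : List (Fin n)
  C1 = u ∷ P ++ w ∷ []
  T : List (Fin n)
  T = u ∷ w ∷ b ∷ []

  C1-cycle : IsCyc C1
  C1-cycle = refl , s≤s (subst (1 ≤_) (sym (length-++ P {w ∷ []})) (subst (1 ≤_) (+-comm 1 (length P)) (s≤s z≤n))) ,
        subst Unique (++-identityʳ (u ∷ P ++ w ∷ [])) (uniq-drop (u ∷ P ++ w ∷ []) b [] (subst Unique (sym (++-assoc (u ∷ P) (w ∷ []) (b ∷ []))) uq))

  T-cycle : IsCyc T
  T-cycle = refl , s≤s (s≤s z≤n) , uniq-cons (∉∷ u≢w (∉∷ u≢b λ ())) (uniq-cons (∉∷ w≢b λ ()) (uniq-cons (λ ()) []))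

  front : List (Edge n)
  front = pathEdges (u ∷ P)
  p : Fin n
  p = lastOf u P

  C-edges : cycleEdges (u ∷ P ++ w ∷ b ∷ []) ≡ (front ++ (p , w) ∷ []) ++ (w , b) ∷ (b , u) ∷ []
  C-edges = trans (cycleEdges-split u P w (b ∷ [])) (cong (_++ (w , b) ∷ (b , u) ∷ []) (pathEdges-snoc u P w))
  C1-edges : cycleEdges C1 ≡ (front ++ (p , w) ∷ []) ++ (w , u) ∷ []
  C1-edges = trans (cycleEdges-split u P w []) (cong (_++ (w , u) ∷ []) (pathEdges-snoc u P w))

  covers-split : Covers K (cycleEdges C1 ++ cycleEdges T)
  covers-split = covers-≋ K cv (≋-by-mult′ eqn)
    where
    eqn : ∀ x y → mult′ x y (cycleEdges C1 ++ cycleEdges T) ≡ mult′ x y (cycleEdges (u ∷ P ++ w ∷ b ∷ []) ++ cycleEdges (u ∷ w ∷ []))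
    eqn x y = trans (cong (λ z → mult′ x y (z ++ cycleEdges T)) C1-edges)
              (trans (mult′-++₃ x y (front ++ (p , w) ∷ []) ((w , u) ∷ []) (cycleEdges T))
              (trans (cong (λ z → z + mult′ x y ((w , u) ∷ []) + mult′ x y (cycleEdges T)) (mult′-++ x y front ((p , w) ∷ [])))
              (trans (lem (mult′ x y front) (δ x y (p , w)) (δ x y (w , u)) (δ x y (u , w)) (δ x y (w , b)) (δ x y (b , u)))
              (sym (trans (cong (λ z → mult′ x y (z ++ cycleEdges (u ∷ w ∷ []))) C-edges)
                   (trans (mult′-++₃ x y (front ++ (p , w) ∷ []) ((w , b) ∷ (b , u) ∷ []) (cycleEdges (u ∷ w ∷ [])))
                          (cong (λ z → z + mult′ x y ((w , b) ∷ (b , u) ∷ []) + mult′ x y (cycleEdges (u ∷ w ∷ []))) (mult′-++ x y front ((p , w) ∷ [])))))))))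
      where
      lem : ∀ z pw wu uw wb bu → ((z + (pw + 0)) + (wu + 0)) + (uw + (wb + (bu + 0))) ≡ ((z + (pw + 0)) + (wb + (bu + 0))) + (uw + (wu + 0))
      lem = solve-∀

  length-C1 : length C1 ≡ length (u ∷ P ++ w ∷ b ∷ []) ∸ 1
  length-C1 = trans (cong suc (length-++ P {w ∷ []})) (trans (lem (length P)) (sym (length-++ P {w ∷ b ∷ []})))
    where
    lem : ∀ k → suc (k + 1) ≡ k + 2
    lem = solve-∀

-- Case C = (u P w b c Q).  Switch (w, b) with origin c: if the terminus is
-- u we obtain the cycles (u P w c Q) and (u w b); if it is the predecessor p
-- of w, the leave becomes (u P b w c Q) ∪ {uw, uw}, with w one step later.
module ShiftCase {M : List ℕ} {l n : ℕ} (K : Packing M l n) (u w b c : Fin n) (P Q : List (Fin n))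
   (uq : Unique (u ∷ P ++ w ∷ b ∷ c ∷ Q))
   (cv : Covers K (cycleEdges (u ∷ P ++ w ∷ b ∷ c ∷ Q) ++ cycleEdges (u ∷ w ∷ []))) where

  L : List (Edge n)
  L = cycleEdges (u ∷ P ++ w ∷ b ∷ c ∷ Q) ++ cycleEdges (u ∷ w ∷ [])

  u∉ : u ∉ P ++ w ∷ b ∷ c ∷ Q
  u∉ = Unique[x∷xs]⇒x∉xs uq
  uqT : Unique (P ++ w ∷ b ∷ c ∷ Q)
  uqT = AllPairs.tail uq
  wnot : w ∉ P ++ b ∷ c ∷ Q
  wnot = uniq-mid P (b ∷ c ∷ Q) uqT
  bnot : b ∉ (P ++ w ∷ []) ++ c ∷ Q
  bnot = uniq-mid (P ++ w ∷ []) (c ∷ Q) (subst Unique (sym (++-assoc P (w ∷ []) (b ∷ c ∷ Q))) uqT)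
  cnot : c ∉ (P ++ w ∷ b ∷ []) ++ Q
  cnot = uniq-mid (P ++ w ∷ b ∷ []) Q (subst Unique (sym (++-assoc P (w ∷ b ∷ []) (c ∷ Q))) uqT)

  u≢w : u ≢ w
  u≢w q = u∉ (∈-++⁺ʳ P (here q))
  u≢b : u ≢ b
  u≢b q = u∉ (∈-++⁺ʳ P (there (here q)))
  u≢c : u ≢ c
  u≢c q = u∉ (∈-++⁺ʳ P (there (there (here q))))
  uQ : u ∉ Q
  uQ m = u∉ (∈-++⁺ʳ P (there (there (there m))))
  wP : w ∉ P
  wP m = wnot (∈-++⁺ˡ m)
  w≢b : w ≢ b
  w≢b q = wnot (∈-++⁺ʳ P (here q))
  w≢c : w ≢ c
  w≢c q = wnot (∈-++⁺ʳ P (there (here q)))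
  wQ : w ∉ Q
  wQ m = wnot (∈-++⁺ʳ P (there (there m)))
  bP : b ∉ P
  bP m = bnot (∈-++⁺ˡ (∈-++⁺ˡ m))
  b≢c : b ≢ c
  b≢c q = bnot (∈-++⁺ʳ (P ++ w ∷ []) (here q))
  bQ : b ∉ Q
  bQ m = bnot (∈-++⁺ʳ (P ++ w ∷ []) (there m))
  cP : c ∉ P
  cP m = cnot (∈-++⁺ˡ (∈-++⁺ˡ m))
  cQ : c ∉ Q
  cQ m = cnot (∈-++⁺ʳ (P ++ w ∷ b ∷ []) m)

  front : List (Edge n)
  front = pathEdges (u ∷ P)
  p : Fin n
  p = lastOf u P
  back : List (Edge n)
  back = pathEdges (c ∷ Q ++ u ∷ [])

  p∈ : p ∈ u ∷ P
  p∈ = lastOf∈ u P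
  p≢ : ∀ {x} → x ≢ u → x ∉ P → p ≢ x
  p≢ xu xP = ∈-∉⇒≢ (∉∷ xu xP) p∈

  front-avoid : ∀ x y → x ≢ u → x ∉ P → mult x y front ≡ 0
  front-avoid x y xu xP = pathEdges-avoid x y (u ∷ P) (∉∷ xu xP)
  back-avoid : ∀ x y → x ≢ c → x ∉ Q → x ≢ u → mult x y back ≡ 0
  back-avoid x y xc xQ xu = pathEdges-avoid x y (c ∷ Q ++ u ∷ []) (∉∷ xc (∉++ Q xQ (∉∷ xu λ ())))

  C-edges : cycleEdges (u ∷ P ++ w ∷ b ∷ c ∷ Q) ≡ (front ++ (p , w) ∷ []) ++ (w , b) ∷ (b , c) ∷ back
  C-edges = trans (cycleEdges-split u P w (b ∷ c ∷ Q)) (cong (_++ (w , b) ∷ (b , c) ∷ back) (pathEdges-snoc u P w))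

  mult-L : ∀ x y → mult x y L ≡ ((mult x y front + (δ x y (p , w) + 0)) + (δ x y (w , b) + (δ x y (b , c) + mult x y back))) + (δ x y (u , w) + (δ x y (w , u) + 0))
  mult-L x y = trans (mult≡mult′ x y L) (trans (cong (λ z → mult′ x y (z ++ cycleEdges (u ∷ w ∷ []))) C-edges)
     (trans (mult′-++₃ x y (front ++ (p , w) ∷ []) ((w , b) ∷ (b , c) ∷ back) (cycleEdges (u ∷ w ∷ [])))
       (cong₂ (λ z1 z2 → (z1 + (δ x y (w , b) + (δ x y (b , c) + z2))) + (δ x y (u , w) + (δ x y (w , u) + 0)))
         (trans (mult′-++ x y front ((p , w) ∷ [])) (cong (_+ (δ x y (p , w) + 0)) (sym (mult≡mult′ x y front)))) (sym (mult≡mult′ x y back)))))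

  -- Multiplicities in L at b and w, which restrict the possible termini.
  mult-b : ∀ y → y ≢ w → y ≢ b → y ≢ c → mult b y L ≡ 0
  mult-b y yw yb yc rewrite mult-L b y | front-avoid b y (≢-sym u≢b) bP | δ0x {x = b} {y = y} (p≢ (≢-sym u≢b) bP) w≢b
          | δ0y {x = b} {y = y} (≢-sym yw) (≢-sym yb) | δ0y {x = b} {y = y} (≢-sym yb) (≢-sym yc) | back-avoid b y b≢c bQ (≢-sym u≢b)
          | δ0x {x = b} {y = y} u≢b w≢b | δ0x {x = b} {y = y} w≢b u≢b = refl

  mult-bc : mult b c L ≡ 1
  mult-bc rewrite mult-L b c | front-avoid b c (≢-sym u≢b) bP | δ0x {x = b} {y = c} (p≢ (≢-sym u≢b) bP) w≢b
          | δ0y {x = b} {y = c} w≢c b≢c | δ11 {x = b} {y = c} | back-avoid b c b≢c bQ (≢-sym u≢b)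
          | δ0x {x = b} {y = c} u≢b w≢b | δ0x {x = b} {y = c} w≢b u≢b = refl

  mult-wc : mult w c L ≡ 0
  mult-wc rewrite mult-L w c | front-avoid w c (≢-sym u≢w) wP | δ0y {x = w} {y = c} (p≢ (≢-sym u≢c) cP) w≢c
          | δ0y {x = w} {y = c} w≢c b≢c | δ0x {x = w} {y = c} (≢-sym w≢b) (≢-sym w≢c) | back-avoid w c w≢c wQ (≢-sym u≢w)
          | δ0y {x = w} {y = c} u≢c w≢c | δ0y {x = w} {y = c} w≢c u≢c = refl

  mult-w : ∀ y → y ≢ w → y ≢ b → y ≢ u → y ≢ p → mult w y L ≡ 0
  mult-w y yw yb yu yp rewrite mult-L w y | front-avoid w y (≢-sym u≢w) wP | δ0y {x = w} {y = y} (≢-sym yp) (≢-sym yw)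
          | δ0y {x = w} {y = y} (≢-sym yw) (≢-sym yb) | δ0x {x = w} {y = y} (≢-sym w≢b) (≢-sym w≢c) | back-avoid w y w≢c wQ (≢-sym u≢w)
          | δ0y {x = w} {y = y} (≢-sym yu) (≢-sym yw) | δ0y {x = w} {y = y} (≢-sym yw) (≢-sym yu) = refl

  open Poles w b w≢b using (Off; pole; endEdges)

  c-off : Off c
  c-off = (≢-sym w≢c , ≢-sym b≢c)

  excess-at-origin : mult w c L < mult b c L
  excess-at-origin = subst₂ _<_ (sym mult-wc) (sym mult-bc) (s≤s z≤n)

  switch : SwitchResult K L w b w≢b c true
  switch = switchLeave K L cv w b w≢b c c-off true excess-at-origin
  K' : Packing M l n
  K' = SwitchResult.K' switch

  C : List (Fin n)
  C = u ∷ P ++ w ∷ b ∷ c ∷ Q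
  C1 : List (Fin n)
  C1 = u ∷ P ++ w ∷ c ∷ Q
  T : List (Fin n)
  T = u ∷ w ∷ b ∷ []
  C2 : List (Fin n)
  C2 = u ∷ (P ++ b ∷ []) ++ w ∷ c ∷ Q

  T-cycle : IsCyc T
  T-cycle = refl , s≤s (s≤s z≤n) , uniq-cons (∉∷ u≢w (∉∷ u≢b λ ())) (uniq-cons (∉∷ w≢b λ ()) (uniq-cons (λ ()) []))

  C1-unique : Unique C1
  C1-unique = subst Unique (++-assoc (u ∷ P) (w ∷ []) (c ∷ Q))
           (uniq-drop (u ∷ P ++ w ∷ []) b (c ∷ Q) (subst Unique (sym (++-assoc (u ∷ P) (w ∷ []) (b ∷ c ∷ Q))) uq))

  C1-cycle : IsCyc C1
  C1-cycle = refl , s≤s (length-++-∷ P w (c ∷ Q)) , C1-unique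

  C2↭C : C2 ↭ C
  C2↭C = subst (_↭ C) (sym (cong (u ∷_) (++-assoc P (b ∷ []) (w ∷ c ∷ Q)))) (++⁺ˡ (u ∷ P) (swap b w ↭-refl))

  C2-unique : Unique C2
  C2-unique = uniq-↭ (↭-sym C2↭C) uq

  C1-edges : cycleEdges C1 ≡ (front ++ (p , w) ∷ []) ++ (w , c) ∷ back
  C1-edges = trans (cycleEdges-split u P w (c ∷ Q)) (cong (_++ (w , c) ∷ back) (pathEdges-snoc u P w))

  C2-edges : cycleEdges C2 ≡ ((front ++ (p , b) ∷ []) ++ (b , w) ∷ []) ++ (w , c) ∷ back
  C2-edges = trans (cycleEdges-split u (P ++ b ∷ []) w (c ∷ Q))
          (cong (_++ (w , c) ∷ back) (trans (pathEdges-snoc u (P ++ b ∷ []) w)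
             (cong₂ (λ z1 z2 → z1 ++ (z2 , w) ∷ []) (pathEdges-snoc u P b) (lastOf-snoc u P b))))

  length-C1 : length C1 ≡ length C ∸ 1
  length-C1 = trans (cong suc (length-++ P {w ∷ c ∷ Q})) (trans (lem (length P) (length Q)) (sym (length-++ P {w ∷ b ∷ c ∷ Q})))
    where
    lem : ∀ k q → suc (k + suc (suc q)) ≡ k + suc (suc (suc q))
    lem = solve-∀

  Goal : Set
  Goal = Decomposition (M ++ (length C ∸ 1) ∷ 3 ∷ []) l n

  mult′-C : ∀ x y → mult′ x y (cycleEdges C) ≡ (mult′ x y front + (δ x y (p , w) + 0)) + (δ x y (w , b) + (δ x y (b , c) + mult′ x y back))
  mult′-C x y = trans (cong (mult′ x y) C-edges) (trans (mult′-++ x y (front ++ (p , w) ∷ []) _) (cong (_+ (δ x y (w , b) + (δ x y (b , c) + mult′ x y back))) (mult′-++ x y front _)))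

  finish₁ : (∀ L' → L' ++ endEdges ((c , false) ∷ (u , true) ∷ []) ≋ L ++ endEdges ((c , true) ∷ (u , false) ∷ []) → Covers K' L') → Goal
  finish₁ tr = subst (λ k → Decomposition (M ++ k ∷ 3 ∷ []) l n) length-C1 (rebuild K' C1 T C1-cycle T-cycle (tr (cycleEdges C1 ++ cycleEdges T) (≋-by-mult′ eqn)))
    where
    eqn : ∀ x y → mult′ x y ((cycleEdges C1 ++ cycleEdges T) ++ endEdges ((c , false) ∷ (u , true) ∷ []))
                ≡ mult′ x y (L ++ endEdges ((c , true) ∷ (u , false) ∷ []))
    eqn x y = trans (mult′-++₃ x y (cycleEdges C1) (cycleEdges T) _)
              (trans (cong (λ z → z + mult′ x y (cycleEdges T) + mult′ x y (endEdges ((c , false) ∷ (u , true) ∷ [])))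
                        (trans (cong (mult′ x y) C1-edges) (trans (mult′-++ x y (front ++ (p , w) ∷ []) _) (cong (_+ (δ x y (w , c) + mult′ x y back)) (mult′-++ x y front _)))))
              (trans (lem (mult′ x y front) (δ x y (p , w)) (δ x y (w , c)) (mult′ x y back) (δ x y (u , w)) (δ x y (w , b)) (δ x y (b , u)) (δ x y (b , c)) (δ x y (w , u)))
              (sym (trans (mult′-++₃ x y (cycleEdges C) (cycleEdges (u ∷ w ∷ [])) _)
                     (cong (λ z → z + mult′ x y (cycleEdges (u ∷ w ∷ [])) + mult′ x y (endEdges ((c , true) ∷ (u , false) ∷ []))) (mult′-C x y))))))
      where
      lem : ∀ z pw wc xx uw wb bu bc wu →
            (((z + (pw + 0)) + (wc + xx)) + (uw + (wb + (bu + 0)))) + (bc + (wu + 0))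
            ≡ (((z + (pw + 0)) + (wb + (bc + xx))) + (uw + (wu + 0))) + (wc + (bu + 0))
      lem = solve-∀

  covers-shifted : (∀ L' → L' ++ endEdges ((c , false) ∷ (p , true) ∷ []) ≋ L ++ endEdges ((c , true) ∷ (p , false) ∷ []) → Covers K' L') →
             Covers K' (cycleEdges C2 ++ cycleEdges (u ∷ w ∷ []))
  covers-shifted tr = tr (cycleEdges C2 ++ cycleEdges (u ∷ w ∷ [])) (≋-by-mult′ eqn)
    where
    eqn : ∀ x y → mult′ x y ((cycleEdges C2 ++ cycleEdges (u ∷ w ∷ [])) ++ endEdges ((c , false) ∷ (p , true) ∷ []))
                ≡ mult′ x y (L ++ endEdges ((c , true) ∷ (p , false) ∷ []))
    eqn x y = trans (mult′-++₃ x y (cycleEdges C2) (cycleEdges (u ∷ w ∷ [])) _)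
              (trans (cong (λ z → z + mult′ x y (cycleEdges (u ∷ w ∷ [])) + mult′ x y (endEdges ((c , false) ∷ (p , true) ∷ [])))
                        (trans (cong (mult′ x y) C2-edges) (trans (mult′-++ x y ((front ++ (p , b) ∷ []) ++ (b , w) ∷ []) _)
                           (cong (_+ (δ x y (w , c) + mult′ x y back)) (trans (mult′-++ x y (front ++ (p , b) ∷ []) _) (cong (_+ (δ x y (b , w) + 0)) (mult′-++ x y front _)))))))
              (trans (lem (mult′ x y front) (δ x y (p , b)) (δ x y (b , p)) (δ x y (b , w)) (δ x y (w , b)) (δ x y (w , c)) (mult′ x y back)
                          (δ x y (u , w)) (δ x y (w , u)) (δ x y (b , c)) (δ x y (w , p)) (δ x y (p , w))
                          (δ-flip x y p b) (δ-flip x y b w) (δ-flip x y w p))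
              (sym (trans (mult′-++₃ x y (cycleEdges C) (cycleEdges (u ∷ w ∷ [])) _)
                     (cong (λ z → z + mult′ x y (cycleEdges (u ∷ w ∷ [])) + mult′ x y (endEdges ((c , true) ∷ (p , false) ∷ []))) (mult′-C x y))))))
      where
      lem0 : ∀ z pb bw wc xx uw wu bc wp → ((((z + (pb + 0)) + (bw + 0)) + (wc + xx)) + (uw + (wu + 0))) + (bc + (wp + 0))
                                       ≡ (((z + (wp + 0)) + (bw + (bc + xx))) + (uw + (wu + 0))) + (wc + (pb + 0))
      lem0 = solve-∀
      lem : ∀ z pb bp bw wb wc xx uw wu bc wp pw → pb ≡ bp → bw ≡ wb → wp ≡ pw →
            ((((z + (pb + 0)) + (bw + 0)) + (wc + xx)) + (uw + (wu + 0))) + (bc + (wp + 0))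
            ≡ (((z + (pw + 0)) + (wb + (bc + xx))) + (uw + (wu + 0))) + (wc + (bp + 0))
      lem z pb bp bw wb wc xx uw wu bc wp pw refl refl refl = lem0 z pb bw wc xx uw wu bc wp

shiftStep : ∀ {M l n} (K : Packing M l n) (u w b c : Fin n) (P Q : List (Fin n)) →
        (uq : Unique (u ∷ P ++ w ∷ b ∷ c ∷ Q)) →
        (cv : Covers K (cycleEdges (u ∷ P ++ w ∷ b ∷ c ∷ Q) ++ cycleEdges (u ∷ w ∷ []))) →
        (∀ (K'' : Packing M l n) → Unique (u ∷ (P ++ b ∷ []) ++ w ∷ c ∷ Q) →
            Covers K'' (cycleEdges (u ∷ (P ++ b ∷ []) ++ w ∷ c ∷ Q) ++ cycleEdges (u ∷ w ∷ [])) →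
            Decomposition (M ++ (length (u ∷ (P ++ b ∷ []) ++ w ∷ c ∷ Q) ∸ 1) ∷ 3 ∷ []) l n) →
        Decomposition (M ++ (length (u ∷ P ++ w ∷ b ∷ c ∷ Q) ∸ 1) ∷ 3 ∷ []) l n
shiftStep {M} {l} {n} K u w b c P Q uq cv rec =
    atTerminus (SwitchResult.y switch) (SwitchResult.c' switch) (SwitchResult.goodY switch) (SwitchResult.endcL switch) (SwitchResult.trans' switch)
  where
  open ShiftCase K u w b c P Q uq cv
  open Poles w b w≢b using (Off; pole; endEdges)
  EndCondition : Fin n → Bool → Set
  EndCondition y c' = ι (y , not c') (c , false) + mult (pole c') y L < ι (y , c') (c , false) + mult (pole (not c')) y L
  Exchange : Fin n → Bool → Set
  Exchange y c' = ∀ L' → L' ++ endEdges ((c , false) ∷ (y , not c') ∷ []) ≋ L ++ endEdges ((c , true) ∷ (y , c') ∷ []) → Covers K' L'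

  terminus-w : ∀ y → Dec (y ≡ c) → Off y → EndCondition y true → Exchange y true → Goal
  terminus-w y (yes refl) gy ec tr = ⊥-elim (<-irrefl refl (subst₂ _<_ (cong₂ _+_ (ι-yes refl) mult-wc) (cong₂ _+_ (ιTF c c) mult-bc) ec))
  terminus-w y (no yc) gy ec tr = ⊥-elim (n≮0 (subst (ι (y , false) (c , false) + mult w y L <_) (cong₂ _+_ (ιTF y c) (mult-b y (proj₁ gy) (proj₂ gy) yc)) ec))

  terminus-b : ∀ y → Dec (y ≡ u) → Dec (y ≡ p) → Dec (y ≡ c) → Off y → EndCondition y false → Exchange y false → Goal
  terminus-b y (yes refl) _ _ gy ec tr = finish₁ tr
  terminus-b y (no yu) (yes refl) _ gy ec tr =
    subst (λ k → Decomposition (M ++ (k ∸ 1) ∷ 3 ∷ []) l n) (↭-length C2↭C) (rec K' C2-unique (covers-shifted tr))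
  terminus-b y (no yu) (no yp) (yes refl) gy ec tr = ⊥-elim (<-irrefl refl (subst₂ _<_ (cong₂ _+_ (ιTF c c) mult-bc) (cong₂ _+_ (ι-yes refl) mult-wc) ec))
  terminus-b y (no yu) (no yp) (no yc) gy ec tr =
    ⊥-elim (n≮0 (subst (ι (y , true) (c , false) + mult b y L <_) (cong₂ _+_ (ιne false yc) (mult-w y (proj₁ gy) (proj₂ gy) yu yp)) ec))

  atTerminus : ∀ y c' → Off y → EndCondition y c' → Exchange y c' → Goal
  atTerminus y true = terminus-w y (y ≟ c)
  atTerminus y false = terminus-b y (y ≟ u) (y ≟ p) (y ≟ c)

onCycleCase : ∀ {M l n} (K : Packing M l n) (u w : Fin n) (P Q : List (Fin n)) → Unique (u ∷ P ++ w ∷ Q) →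
        Covers K (cycleEdges (u ∷ P ++ w ∷ Q) ++ cycleEdges (u ∷ w ∷ [])) → Q ≢ [] →
        Decomposition (M ++ (length (u ∷ P ++ w ∷ Q) ∸ 1) ∷ 3 ∷ []) l n
onCycleCase K u w P [] uq cv ne = ⊥-elim (ne refl)
onCycleCase {M} {l} {n} K u w P (b ∷ []) uq cv ne =
  subst (λ k → Decomposition (M ++ k ∷ 3 ∷ []) l n) length-C1 (rebuild K C1 T C1-cycle T-cycle covers-split)
  where open AdjacentCase K u w b P uq cv
onCycleCase K u w P (b ∷ c ∷ Q) uq cv ne =
  shiftStep K u w b c P Q uq cv (λ K'' uq'' cv'' → onCycleCase K'' u w (P ++ b ∷ []) (c ∷ Q) uq'' cv'' (λ ()))

-- Reduction of the leave C ∪ {vw, vw} (v ∈ C, |C| = m ≥ 4) to the cases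
-- above, after rotating C to start at v and, if w is the last vertex,
-- reversing it.
module _ {M : List ℕ} {l n m : ℕ} (K : Packing M l n) (v w : Fin n) (v≢w : v ≢ w) (m4 : 4 ≤ m) where
  fromRootedCycle : ∀ R → Unique (v ∷ R) → length (v ∷ R) ≡ m → Covers K (cycleEdges (v ∷ R) ++ cycleEdges (v ∷ w ∷ [])) →
          Decomposition (M ++ (m ∸ 1) ∷ 3 ∷ []) l n
  fromRootedCycle R uq len cv = go (w ∈? R)
    where
    go : Dec (w ∈ R) → Decomposition (M ++ (m ∸ 1) ∷ 3 ∷ []) l n
    go (yes mw) with ∈-∃++ mw
    ... | P1 , [] , refl = subst (λ k → Decomposition (M ++ (k ∸ 1) ∷ 3 ∷ []) l n) lenr (onCycleCase K v w [] (reverse P1) uqr cvr ne)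
      where
      eqr : v ∷ reverse (P1 ++ w ∷ []) ≡ v ∷ w ∷ reverse P1
      eqr = cong (v ∷_) (reverse-++ P1 (w ∷ []))
      uqr : Unique (v ∷ w ∷ reverse P1)
      uqr = subst Unique eqr (uniq-↭ (↭-sym (prep v (↭-reverse (P1 ++ w ∷ [])))) uq)
      cvr : Covers K (cycleEdges (v ∷ w ∷ reverse P1) ++ cycleEdges (v ∷ w ∷ []))
      cvr = covers-≋ K cv (++-cong (≋-trans (≋-≡ (cong cycleEdges (sym eqr))) (cycleEdges-reverse v (P1 ++ w ∷ []))) ≋-refl)
      lenr : length (v ∷ w ∷ reverse P1) ≡ m
      lenr = trans (cong length (sym eqr)) (trans (cong suc (length-reverse (P1 ++ w ∷ []))) len)
      ne : reverse P1 ≢ []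
      ne e = bad (subst (λ z → 4 ≤ suc (suc (length z))) e (subst (4 ≤_) (sym lenr) m4))
        where
        bad : ¬ (4 ≤ 2)
        bad (s≤s (s≤s ()))
    ... | P1 , b ∷ Q1 , refl = subst (λ k → Decomposition (M ++ (k ∸ 1) ∷ 3 ∷ []) l n) len (onCycleCase K v w P1 (b ∷ Q1) uq cv (λ ()))
    go (no nw) = caseR R uq len cv (∉∷ (≢-sym v≢w) nw)
      where
      caseR : ∀ R → Unique (v ∷ R) → length (v ∷ R) ≡ m → Covers K (cycleEdges (v ∷ R) ++ cycleEdges (v ∷ w ∷ [])) → w ∉ v ∷ R →
              Decomposition (M ++ (m ∸ 1) ∷ 3 ∷ []) l n
      caseR (a ∷ b ∷ c ∷ Q) uq len cv nw' = subst (λ k → Decomposition (M ++ k ∷ 3 ∷ []) l n) (cong (_∸ 1) len) (offCycleCase K v w a b c Q uq nw' cv)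
      caseR [] uq len cv nw' = ⊥-elim (bad (subst (4 ≤_) (sym len) m4))
        where bad : ¬ (4 ≤ 1)
              bad (s≤s ())
      caseR (a ∷ []) uq len cv nw' = ⊥-elim (bad (subst (4 ≤_) (sym len) m4))
        where bad : ¬ (4 ≤ 2)
              bad (s≤s (s≤s ()))
      caseR (a ∷ b ∷ []) uq len cv nw' = ⊥-elim (bad (subst (4 ≤_) (sym len) m4))
        where bad : ¬ (4 ≤ 3)
              bad (s≤s (s≤s (s≤s ())))

  fromCycle : ∀ C → IsCyc C → length C ≡ m → v ∈ C → Covers K (cycleEdges C ++ cycleEdges (v ∷ w ∷ [])) →
          Decomposition (M ++ (m ∸ 1) ∷ 3 ∷ []) l n
  fromCycle C (_ , _ , uC) len vC cv with ∈-∃++ vC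
  ... | A , B , refl = fromRootedCycle (B ++ A) (uniq-↭ (++-comm A (v ∷ B)) uC) (trans (length-++-comm (v ∷ B) A) len)
                         (covers-≋ K cv (++-cong (≋-sym (cycleEdges-rotate A (v ∷ B))) ≋-refl))

twoCycle-normal : ∀ {n} (v : Fin n) E → length E ≡ 2 → IsCyc E → v ∈ E →
        Σ (Fin n) (λ w → v ≢ w × cycleEdges (v ∷ w ∷ []) ≋ cycleEdges E)
twoCycle-normal v (e1 ∷ e2 ∷ []) _ (_ , _ , uE) (here refl) = e2 , All.head (AllPairs.head uE) , ≋-refl
twoCycle-normal v (e1 ∷ e2 ∷ []) _ (_ , _ , uE) (there (here refl)) = e1 , (λ q → All.head (AllPairs.head uE) (sym q)) , ++-comm≋ ((v , e1) ∷ []) ((e1 , v) ∷ [])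
twoCycle-normal v (e1 ∷ e2 ∷ []) _ _ (there (there ()))

splitLastTwo : ∀ {M l n m k} (D : Decomposition (M ++ m ∷ k ∷ []) l n) Gs (C E : List (Fin n)) →
  Decomposition.cycles D ≡ Gs ++ C ∷ E ∷ [] →
  Σ[ K ∈ Packing M l n ] (IsCyc C × IsCyc E × length C ≡ m × length E ≡ k × Covers K (cycleEdges C ++ cycleEdges E))
splitLastTwo {M} {l} {m = m} {k} D Gs C E eqc = K , cycC , cycE , lenC , lenE , cvK
  where
  open Decomposition D
  lens : map length Gs ++ length C ∷ length E ∷ [] ≡ M ++ m ∷ k ∷ []
  lens = trans (sym (map-++ length Gs (C ∷ E ∷ []))) (trans (cong (map length) (sym eqc)) lengths)
  lensGs : map length Gs ≡ M
  lensGs = proj₁ (++-snoc₂-injective (map length Gs) M (length C) (length E) m k lens)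
  lenC : length C ≡ m
  lenC = proj₁ (proj₂ (++-snoc₂-injective (map length Gs) M (length C) (length E) m k lens))
  lenE : length E ≡ k
  lenE = proj₂ (proj₂ (++-snoc₂-injective (map length Gs) M (length C) (length E) m k lens))
  parts : All IsCyc Gs × All IsCyc (C ∷ E ∷ [])
  parts = AllP.++⁻ Gs (subst (All IsCyc) eqc areCycles)
  cycC : IsCyc C
  cycC = All.head (proj₂ parts)
  cycE : IsCyc E
  cycE = All.head (All.tail (proj₂ parts))
  K : Packing M l _
  K = record { Gs = Gs ; mt = matching ; lensG = lensGs ; cycG = proj₁ parts ; evenC = evenCase ; oddC = oddCase }
  cvK : Covers K (cycleEdges C ++ cycleEdges E)
  cvK u v uv = trans (sym (mult-lastTwo Gs C E matching u v)) (subst (λ cs → mult u v (concatMap cycleEdges cs ++ matching) ≡ l) eqc (covers u v uv))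

-- For
-- m = 3 the leave is already a 2-cycle plus a 3-cycle; otherwise write E as
-- the double edge vw and apply the switching argument of fromCycle.
lemma3p6 : (M : List ℕ) (l n m : ℕ) → All (2 ≤_) M → 1 ≤ l → 1 ≤ n → 3 ≤ m →
    Σ (Decomposition (M ++ m ∷ 2 ∷ []) l n) LastTwoShareVertex →
    Decomposition (M ++ (m ∸ 1) ∷ 3 ∷ []) l n
lemma3p6 M l n m _ _ _ 3≤m (D , Gs , C , E , eqc , v , v∈C , v∈E)
  with splitLastTwo D Gs C E eqc | m ℕ.≟ 3
... | K , cycC , cycE , lenC , lenE , cov | yes refl =
  subst₂ (λ a b → Decomposition (M ++ a ∷ b ∷ []) l n) lenE lenC
    (rebuild K E C cycE cycC (covers-≋ K cov (++-comm≋ (cycleEdges E) (cycleEdges C))))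
... | K , cycC , cycE , lenC , lenE , cov | no m≢3
  with twoCycle-normal v E lenE cycE v∈E
...   | w , v≢w , vw≋E =
  fromCycle K v w v≢w (≤∧≢⇒< 3≤m (λ q → m≢3 (sym q))) C cycC lenC v∈C (covers-≋ K cov (++-cong ≋-refl vw≋E))
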